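{- Let $s,k,n$ be integers and $m\ge 1$. Let $p,q,r,a,b,c$ be real numbers with $c\neq 0$, let $(P_n)_{n\in\mathbb{Z}}=\mathcal{P}(x)(p,q,r;a,b,c)$, $(U_n)_{n\in\mathbb{Z}}=\mathcal{P}(x)(0,0,1;a,b,c)$, and $\Delta_{\mathcal{P}}=(q^2-apq)x^2+(2qr-apr-bpq)x+(r^2-bpr-cp^2)$. Let $d_1,\dots,d_m$ and $e_1,\dots,e_m$ be integers. Then \[ \det\Big(\Big[\prod_{f=j+1}^m P_{s+k(n+i+d_f)}\prod_{g=1}^j P_{s+k(n+i+e_g)}\Big]_{0\le i,j\le m}\Big) = (-\Delta_{\mathcal{P}})^{\binom{m+1}{2}}(-c)^{(s+kn)\binom{m+1}{2}+k\binom{m+1}{3}}\prod_{l=1}^m U_{kl}^{m+1-l}\cdot\prod_{1\le i\le j\le m}(-c)^{kd_j}U_{k(e_i-d_j)}. \]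
   Context: For real numbers $p,q,r,a,b,c$ with $c\neq 0$, $\mathcal{P}(x)(p,q,r;a,b,c)=(P_n)_{n\in\mathbb{Z}}$ denotes the sequence of polynomials in $x$ defined by $P_0=p$, $P_1=qx+r$, $P_{n+2}=(ax+b)P_{n+1}+cP_n$ for $n\ge 0$, and for $n<0$ by $P_n=-\frac{ax+b}{c}P_{n+1}+\frac{1}{c}P_{n+2}$; so $U_0=0$, $U_1=1$. $[M_{i,j}]_{0\le i,j\le m}$ is the $(m+1)\times(m+1)$ matrix with entry $M_{i,j}$ in row $i$, column $j$; empty products equal $1$. -}

module Defs where

open import Level using (Level)
open import Algebra.Bundles using (CommutativeRing)
open import Data.Nat as ℕ using (ℕ; zero; suc; _<ᵇ_; _≤ᵇ_)
open import Data.Integer as ℤ using (ℤ; +_; -[1+_])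
open import Data.Fin using (Fin; zero; suc; toℕ; punchIn)
open import Data.Bool using (if_then_else_)
open import Data.Product using (_×_; _,_; proj₁; proj₂)

module RingDefs {c ℓ : Level} (R : CommutativeRing c ℓ) where
  open CommutativeRing R hiding (zero)

  pow : Carrier → ℕ → Carrier
  pow u zero    = 1#
  pow u (suc n) = u * pow u n

  zpow : Carrier → Carrier → ℤ → Carrier
  zpow u uinv (+ n)      = pow u n
  zpow u uinv -[1+ n ]   = pow uinv (suc n)

  sumFin : (m : ℕ) → (Fin m → Carrier) → Carrier
  sumFin zero    f = 0#
  sumFin (suc m) f = f zero + sumFin m (λ t → f (suc t))

  prodFin : (m : ℕ) → (Fin m → Carrier) → Carrier
  prodFin zero    f = 1#
  prodFin (suc m) f = f zero * prodFin m (λ t → f (suc t))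

  det : (m : ℕ) → (Fin m → Fin m → Carrier) → Carrier
  det zero    M = 1#
  det (suc m) M =
    sumFin (suc m) (λ j → pow (- 1#) (toℕ j) * (M zero j *
      det m (λ i' j' → M (suc i') (punchIn j j'))))

  -- The sequence P(x)(p,q,r;a,b,c) evaluated at x, indexed by ℤ.
  -- cinv is the inverse of c (c * cinv ≈ 1).
  module _ (p q r a b cc cinv x : Carrier) where
    -- (P_n, P_{n+1}) for n ≥ 0
    fwd : ℕ → Carrier × Carrier
    fwd zero    = p , (q * x + r)
    fwd (suc n) = proj₂ (fwd n) , ((a * x + b) * proj₂ (fwd n) + cc * proj₁ (fwd n))

    -- (P_{-n}, P_{-n+1}) for n ≥ 0
    bwd : ℕ → Carrier × Carrier
    bwd zero    = p , (q * x + r)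
    bwd (suc n) = ((- ((a * x + b) * cinv)) * proj₁ (bwd n) + cinv * proj₂ (bwd n))
                  , proj₁ (bwd n)

    Pseq : ℤ → Carrier
    Pseq (+ n)    = proj₁ (fwd n)
    Pseq -[1+ n ] = proj₁ (bwd (suc n))

    DeltaP : Carrier
    DeltaP = (q * q - a * p * q) * (x * x)
           + ((q * r + q * r) - a * p * r - b * p * q) * x
           + (r * r - b * p * r - cc * (p * p))

-- Put N_i = s + k(n + i) and v_i = (P_{N_i}, P_{N_i + 1}). Every term is a linear form in any two
-- consecutive ones, P_{N + K} = c U_{K-1} P_N + U_K P_{N + 1}, so the (i, j) entry of the matrix
-- is ∏_{t ≥ j} L_t · v_i ∏_{t < j} M_t · v_i, with L_t and M_t the coefficient vectors for
-- K = k d_t and K = k e_t. Such a determinant equals ∏_{i < i'} v_i ∧ v_{i'} ∏_{i ≤ j} L_j ∧ M_i,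
-- where (u₁, u₂) ∧ (x₁, x₂) = u₁ x₂ - u₂ x₁: column operations clear the first row at the cost of
-- the factors L_t · v₀, which are cancelled after replacing every point u by (1 - T)(1, 0) + T u
-- over R[T] and then evaluating at T = 1. The brackets are evaluated with the Cassini-type identity
-- P_{N+1}² - w P_N P_{N+1} - c P_N² = (-c)^N Δ_P (w = ax + b), which gives
-- v_i ∧ v_{i'} = -Δ_P (-c)^{N_i} U_{k(i' - i)} and L_j ∧ M_i = (-c)^{k d_j} U_{k(e_i - d_j)};
-- collecting the powers produces the binomial coefficients.

module Submission where

open import Defs
open import Level using (Level)
open import Algebra.Bundles using (CommutativeRing)
open import Data.Nat as ℕ using (ℕ; suc; _∸_; _<ᵇ_; _≤ᵇ_; _≥_)
open import Data.Nat.Combinatorics using (_C_)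
open import Data.Integer as ℤ using (ℤ; +_)
open import Data.Fin using (Fin; toℕ)
open import Data.Bool using (if_then_else_)

open import Level using (_⊔_)
open import Algebra.Structures using (IsCommutativeRing)
open import Algebra.Morphism.Structures using (IsRingHomomorphism)
import Algebra.Properties.Ring as RingProperties
import Algebra.Solver.Ring
import Algebra.Solver.Ring.AlmostCommutativeRing as ACR
open import Data.Nat using (zero)
import Data.Nat.Properties as ℕP
open import Data.Nat.Combinatorics using (nCk+nC[k+1]≡[n+1]C[k+1]; nC1≡n)
open import Data.Integer using (-[1+_])
import Data.Integer.Properties as ℤP
open import Data.Integer.Tactic.RingSolver using (solve-∀)
open import Data.Fin as Fin using (zero; suc; punchIn; punchOut; inject₁; fromℕ)
import Data.Fin.Properties as FinP
open import Data.Bool using (Bool; true; false)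
open import Data.List using (List; []; _∷_)
open import Data.Maybe using (Maybe; just; nothing)
open import Data.Product using (Σ; _,_; proj₁; _×_)
open import Data.Empty using (⊥-elim)
open import Function using (_∘_)
open import Relation.Nullary using (yes; no)
open import Relation.Binary.PropositionalEquality as ≡ using (_≡_; _≢_)

module IntegerCoefficientSolver {c ℓ : Level} (R : CommutativeRing c ℓ) where
  open CommutativeRing R
  open RingProperties ring using (-‿involutive; -‿distribˡ-*; -‿+-comm; -0#≈0#)
  open import Relation.Binary.Reasoning.Setoid setoid

  private
    -- A separate clause for 1, so that ιℕ 1 is 1# itself rather than 1# + 0#.
    ιℕ : ℕ → Carrier
    ιℕ zero          = 0#
    ιℕ (suc zero)    = 1#
    ιℕ (suc (suc n)) = 1# + ιℕ (suc n)

    ιℕ-suc : ∀ n → ιℕ (suc n) ≈ 1# + ιℕ n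
    ιℕ-suc zero    = sym (+-identityʳ 1#)
    ιℕ-suc (suc n) = refl

    ιℤ : ℤ → Carrier
    ιℤ (+ n)    = ιℕ n
    ιℤ -[1+ n ] = - ιℕ (suc n)

    ιℤ-neg : ∀ i → ιℤ (ℤ.- i) ≈ - ιℤ i
    ιℤ-neg (+ zero)  = sym -0#≈0#
    ιℤ-neg (+ suc n) = refl
    ιℤ-neg -[1+ n ]  = sym (-‿involutive _)

    ιℤ-suc : ∀ i → ιℤ (ℤ.suc i) ≈ 1# + ιℤ i
    ιℤ-suc (+ n)            = ιℕ-suc n
    ιℤ-suc -[1+ zero ]      = sym (-‿inverseʳ 1#)
    ιℤ-suc -[1+ suc n ] = begin
      - ιℕ (suc n)                ≈⟨ sym (+-identityˡ _) ⟩
      0# + - ιℕ (suc n)           ≈⟨ +-congʳ (sym (-‿inverseʳ 1#)) ⟩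
      (1# + - 1#) + - ιℕ (suc n)  ≈⟨ +-assoc _ _ _ ⟩
      1# + (- 1# + - ιℕ (suc n))  ≈⟨ +-congˡ (-‿+-comm _ _) ⟩
      1# + - (1# + ιℕ (suc n))    ≈⟨ +-congˡ (-‿cong (sym (ιℕ-suc (suc n)))) ⟩
      1# + - ιℕ (suc (suc n))     ∎

    ιℤ-+-pos : ∀ n j → ιℤ (+ n ℤ.+ j) ≈ ιℕ n + ιℤ j
    ιℤ-+-pos zero j = begin
      ιℤ (+ 0 ℤ.+ j)  ≡⟨ ≡.cong ιℤ (ℤP.+-identityˡ j) ⟩
      ιℤ j            ≈⟨ sym (+-identityˡ _) ⟩
      0# + ιℤ j       ∎
    ιℤ-+-pos (suc n) j = begin
      ιℤ (+ suc n ℤ.+ j)      ≡⟨ ≡.cong ιℤ (ℤP.suc-+ n j) ⟩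
      ιℤ (ℤ.suc (+ n ℤ.+ j))  ≈⟨ ιℤ-suc (+ n ℤ.+ j) ⟩
      1# + ιℤ (+ n ℤ.+ j)     ≈⟨ +-congˡ (ιℤ-+-pos n j) ⟩
      1# + (ιℕ n + ιℤ j)      ≈⟨ sym (+-assoc _ _ _) ⟩
      (1# + ιℕ n) + ιℤ j      ≈⟨ +-congʳ (sym (ιℕ-suc n)) ⟩
      ιℕ (suc n) + ιℤ j       ∎

    ιℤ-+ : ∀ i j → ιℤ (i ℤ.+ j) ≈ ιℤ i + ιℤ j
    ιℤ-+ (+ n)    j = ιℤ-+-pos n j
    ιℤ-+ -[1+ n ] j = begin
      ιℤ (-[1+ n ] ℤ.+ j)           ≡⟨ ≡.cong ιℤ negated ⟩
      ιℤ (ℤ.- (+ suc n ℤ.+ ℤ.- j))  ≈⟨ ιℤ-neg (+ suc n ℤ.+ ℤ.- j) ⟩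
      - ιℤ (+ suc n ℤ.+ ℤ.- j)      ≈⟨ -‿cong (ιℤ-+-pos (suc n) (ℤ.- j)) ⟩
      - (ιℕ (suc n) + ιℤ (ℤ.- j))   ≈⟨ -‿cong (+-congˡ (ιℤ-neg j)) ⟩
      - (ιℕ (suc n) + - ιℤ j)       ≈⟨ sym (-‿+-comm _ _) ⟩
      - ιℕ (suc n) + - - ιℤ j       ≈⟨ +-congˡ (-‿involutive _) ⟩
      - ιℕ (suc n) + ιℤ j           ∎
      where
      negated : -[1+ n ] ℤ.+ j ≡ ℤ.- (+ suc n ℤ.+ ℤ.- j)
      negated = ≡.sym (≡.trans (ℤP.neg-distrib-+ (+ suc n) (ℤ.- j))
                               (≡.cong (λ k → -[1+ n ] ℤ.+ k) (ℤP.neg-involutive j)))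

    ιℤ-*-pos : ∀ n j → ιℤ (+ n ℤ.* j) ≈ ιℕ n * ιℤ j
    ιℤ-*-pos zero j = begin
      ιℤ (+ 0 ℤ.* j)  ≡⟨ ≡.cong ιℤ (ℤP.*-zeroˡ j) ⟩
      0#              ≈⟨ sym (zeroˡ _) ⟩
      0# * ιℤ j       ∎
    ιℤ-*-pos (suc n) j = begin
      ιℤ (+ suc n ℤ.* j)       ≡⟨ ≡.cong ιℤ (ℤP.suc-* (+ n) j) ⟩
      ιℤ (j ℤ.+ + n ℤ.* j)     ≈⟨ ιℤ-+ j _ ⟩
      ιℤ j + ιℤ (+ n ℤ.* j)    ≈⟨ +-cong (sym (*-identityˡ _)) (ιℤ-*-pos n j) ⟩
      1# * ιℤ j + ιℕ n * ιℤ j  ≈⟨ sym (distribʳ _ _ _) ⟩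
      (1# + ιℕ n) * ιℤ j       ≈⟨ *-congʳ (sym (ιℕ-suc n)) ⟩
      ιℕ (suc n) * ιℤ j        ∎

    ιℤ-* : ∀ i j → ιℤ (i ℤ.* j) ≈ ιℤ i * ιℤ j
    ιℤ-* (+ n)    j = ιℤ-*-pos n j
    ιℤ-* -[1+ n ] j = begin
      ιℤ (-[1+ n ] ℤ.* j)       ≡⟨ ≡.cong ιℤ (≡.sym (ℤP.neg-distribˡ-* (+ suc n) j)) ⟩
      ιℤ (ℤ.- (+ suc n ℤ.* j))  ≈⟨ ιℤ-neg (+ suc n ℤ.* j) ⟩
      - ιℤ (+ suc n ℤ.* j)      ≈⟨ -‿cong (ιℤ-*-pos (suc n) j) ⟩
      - (ιℕ (suc n) * ιℤ j)     ≈⟨ -‿distribˡ-* _ _ ⟩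
      - ιℕ (suc n) * ιℤ j       ∎

    ιℤ-homomorphism : ℤ.+-*-rawRing ACR.-Raw-AlmostCommutative⟶ ACR.fromCommutativeRing R
    ιℤ-homomorphism = record
      { ⟦_⟧ = ιℤ ; +-homo = ιℤ-+ ; *-homo = ιℤ-* ; -‿homo = ιℤ-neg
      ; 0-homo = refl ; 1-homo = refl }

    ιℤ-≟ : ∀ i j → Maybe (ιℤ i ≈ ιℤ j)
    ιℤ-≟ i j with i ℤ.≟ j
    ... | yes i≡j = just (reflexive (≡.cong ιℤ i≡j))
    ... | no _    = nothing

  open Algebra.Solver.Ring ℤ.+-*-rawRing (ACR.fromCommutativeRing R) ιℤ-homomorphism ιℤ-≟ public
    using (solve; _:=_; _:+_; _:*_; _:-_; :-_; con)

module FiniteProducts {c ℓ : Level} (R : CommutativeRing c ℓ) where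
  open CommutativeRing R hiding (zero)
  open RingDefs R
  open IntegerCoefficientSolver R
  open import Relation.Binary.Reasoning.Setoid setoid

  sumFin-cong : ∀ n {f g : Fin n → Carrier} → (∀ i → f i ≈ g i) → sumFin n f ≈ sumFin n g
  sumFin-cong zero    f≈g = refl
  sumFin-cong (suc n) f≈g = +-cong (f≈g zero) (sumFin-cong n (λ i → f≈g (suc i)))

  prodFin-cong : ∀ n {f g : Fin n → Carrier} → (∀ i → f i ≈ g i) → prodFin n f ≈ prodFin n g
  prodFin-cong zero    f≈g = refl
  prodFin-cong (suc n) f≈g = *-cong (f≈g zero) (prodFin-cong n (λ i → f≈g (suc i)))

  sumFin-zero : ∀ n (f : Fin n → Carrier) → (∀ i → f i ≈ 0#) → sumFin n f ≈ 0#
  sumFin-zero zero    f f≈0 = refl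
  sumFin-zero (suc n) f f≈0 =
    trans (+-cong (f≈0 zero) (sumFin-zero n _ (λ i → f≈0 (suc i)))) (+-identityˡ 0#)

  sumFin-*ˡ : ∀ n x (f : Fin n → Carrier) → sumFin n (λ i → x * f i) ≈ x * sumFin n f
  sumFin-*ˡ zero    x f = sym (zeroʳ x)
  sumFin-*ˡ (suc n) x f = trans (+-congˡ (sumFin-*ˡ n x (λ i → f (suc i)))) (sym (distribˡ x _ _))

  sumFin-linear : ∀ n x y (f g : Fin n → Carrier) →
    sumFin n (λ i → x * f i + y * g i) ≈ x * sumFin n f + y * sumFin n g
  sumFin-linear zero x y f g =
    solve 2 (λ x y → con (+ 0) := x :* con (+ 0) :+ y :* con (+ 0)) refl x y
  sumFin-linear (suc n) x y f g =
    trans (+-congˡ (sumFin-linear n x y (λ i → f (suc i)) (λ i → g (suc i))))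
          (solve 6 (λ x y a b s t → (x :* a :+ y :* b) :+ (x :* s :+ y :* t) := x :* (a :+ s) :+ y :* (b :+ t))
                 refl x y _ _ _ _)

  sumFin-adjacent-pair : ∀ n (f : Fin (suc n) → Carrier) (j : Fin n) →
    (∀ i → i ≢ inject₁ j → i ≢ suc j → f i ≈ 0#) → f (inject₁ j) + f (suc j) ≈ 0# →
    sumFin (suc n) f ≈ 0#
  sumFin-adjacent-pair (suc n) f zero f≈0 pair≈0 = begin
    f zero + (f (suc zero) + sumFin n (λ i → f (suc (suc i))))
      ≈⟨ +-congˡ (+-congˡ (sumFin-zero n _ (λ i → f≈0 (suc (suc i)) (λ ()) (λ ())))) ⟩
    f zero + (f (suc zero) + 0#)  ≈⟨ +-congˡ (+-identityʳ _) ⟩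
    f zero + f (suc zero)         ≈⟨ pair≈0 ⟩
    0#                            ∎
  sumFin-adjacent-pair (suc n) f (suc j) f≈0 pair≈0 =
    trans (+-cong (f≈0 zero (λ ()) (λ ()))
                  (sumFin-adjacent-pair n (λ i → f (suc i)) j
                     (λ i i≢ i≢′ → f≈0 (suc i) (i≢ ∘ FinP.suc-injective) (i≢′ ∘ FinP.suc-injective))
                     pair≈0))
          (+-identityˡ 0#)

  prodFin-* : ∀ n (f g : Fin n → Carrier) → prodFin n (λ i → f i * g i) ≈ prodFin n f * prodFin n g
  prodFin-* zero    f g = sym (*-identityʳ 1#)
  prodFin-* (suc n) f g =
    trans (*-congˡ (prodFin-* n (λ i → f (suc i)) (λ i → g (suc i))))
          (solve 4 (λ a b c d → (a :* b) :* (c :* d) := (a :* c) :* (b :* d)) refl _ _ _ _)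

  prodFin-ones : ∀ n (f : Fin n → Carrier) → (∀ i → f i ≈ 1#) → prodFin n f ≈ 1#
  prodFin-ones zero    f f≈1 = refl
  prodFin-ones (suc n) f f≈1 =
    trans (*-cong (f≈1 zero) (prodFin-ones n _ (λ i → f≈1 (suc i)))) (*-identityʳ 1#)

  prodFin-const : ∀ n x → prodFin n (λ _ → x) ≈ pow x n
  prodFin-const zero    x = refl
  prodFin-const (suc n) x = *-congˡ (prodFin-const n x)

  prodFin-init-last : ∀ n (f : Fin (suc n) → Carrier) →
    prodFin (suc n) f ≈ prodFin n (λ i → f (inject₁ i)) * f (fromℕ n)
  prodFin-init-last zero    f = *-comm _ _
  prodFin-init-last (suc n) f = trans (*-congˡ (prodFin-init-last n (λ i → f (suc i)))) (sym (*-assoc _ _ _))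

  prodFin-punchIn : ∀ n (f : Fin (suc n) → Carrier) j → prodFin (suc n) f ≈ f j * prodFin n (λ k → f (punchIn j k))
  prodFin-punchIn n       f zero    = refl
  prodFin-punchIn (suc n) f (suc j) =
    trans (*-congˡ (prodFin-punchIn n (λ k → f (suc k)) j))
          (solve 3 (λ x y z → x :* (y :* z) := y :* (x :* z)) refl _ _ _)

  prodFin-if-extract : ∀ n (b b′ : Fin n → Bool) (f : Fin n → Carrier) t₀ →
    b t₀ ≡ true → b′ t₀ ≡ false → (∀ t → t ≢ t₀ → b t ≡ b′ t) →
    prodFin n (λ t → if b t then f t else 1#) ≈ f t₀ * prodFin n (λ t → if b′ t then f t else 1#)
  prodFin-if-extract (suc n) b b′ f zero b≡true b′≡false b≡b′ with b zero | b′ zero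
  ... | true | false =
    *-congˡ (trans (prodFin-cong n (λ t → reflexive (≡.cong (λ β → if β then f (suc t) else 1#) (b≡b′ (suc t) (λ ())))))
                   (sym (*-identityˡ _)))
  prodFin-if-extract (suc n) b b′ f (suc t₀) b≡true b′≡false b≡b′ = begin
    head b * prodFin n (λ t → if b (suc t) then f (suc t) else 1#)
      ≈⟨ *-congˡ (prodFin-if-extract n (λ t → b (suc t)) (λ t → b′ (suc t)) (λ t → f (suc t)) t₀ b≡true b′≡false
                    (λ t t≢ → b≡b′ (suc t) (λ eq → t≢ (FinP.suc-injective eq)))) ⟩
    head b * (f (suc t₀) * prodFin n (λ t → if b′ (suc t) then f (suc t) else 1#))
      ≈⟨ solve 3 (λ x y z → x :* (y :* z) := y :* (x :* z)) refl _ _ _ ⟩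
    f (suc t₀) * (head b * prodFin n (λ t → if b′ (suc t) then f (suc t) else 1#))
      ≡⟨ ≡.cong (λ β → f (suc t₀) * (head (λ _ → β) * _)) (b≡b′ zero (λ ())) ⟩
    f (suc t₀) * (head b′ * prodFin n (λ t → if b′ (suc t) then f (suc t) else 1#)) ∎
    where
    head : (Fin (suc n) → Bool) → Carrier
    head β = if β zero then f zero else 1#

  prodFin-staircase : ∀ m (f : ℕ → Carrier) →
    prodFin (suc m) (λ t → f (toℕ t)) * prodFin m (λ t → pow (f (toℕ t)) (m ∸ toℕ t))
    ≈ prodFin (suc m) (λ t → pow (f (toℕ t)) (suc m ∸ toℕ t))
  prodFin-staircase m f = sym (begin
    prodFin (suc m) (λ t → pow (f (toℕ t)) (suc m ∸ toℕ t))
      ≈⟨ prodFin-cong (suc m) (λ t → reflexive (≡.cong (pow (f (toℕ t))) (ℕP.+-∸-assoc 1 (FinP.toℕ≤pred[n] t)))) ⟩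
    prodFin (suc m) (λ t → f (toℕ t) * pow (f (toℕ t)) (m ∸ toℕ t))
      ≈⟨ prodFin-* (suc m) (λ t → f (toℕ t)) (λ t → pow (f (toℕ t)) (m ∸ toℕ t)) ⟩
    prodFin (suc m) (λ t → f (toℕ t)) * prodFin (suc m) (λ t → pow (f (toℕ t)) (m ∸ toℕ t))
      ≈⟨ *-congˡ (prodFin-init-last m (λ t → pow (f (toℕ t)) (m ∸ toℕ t))) ⟩
    prodFin (suc m) (λ t → f (toℕ t))
      * (prodFin m (λ t → pow (f (toℕ (inject₁ t))) (m ∸ toℕ (inject₁ t))) * pow (f (toℕ (fromℕ m))) (m ∸ toℕ (fromℕ m)))
      ≈⟨ *-congˡ (*-cong (prodFin-cong m (λ t → reflexive (≡.cong (λ i → pow (f i) (m ∸ i)) (FinP.toℕ-inject₁ t))))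
                         (reflexive (≡.cong (λ i → pow (f i) (m ∸ i)) (FinP.toℕ-fromℕ m)))) ⟩
    prodFin (suc m) (λ t → f (toℕ t)) * (prodFin m (λ t → pow (f (toℕ t)) (m ∸ toℕ t)) * pow (f m) (m ∸ m))
      ≈⟨ *-congˡ (trans (*-congˡ (reflexive (≡.cong (pow (f m)) (ℕP.n∸n≡0 m)))) (*-identityʳ _)) ⟩
    prodFin (suc m) (λ t → f (toℕ t)) * prodFin m (λ t → pow (f (toℕ t)) (m ∸ toℕ t)) ∎)

  pow-+ : ∀ x m n → pow x (m ℕ.+ n) ≈ pow x m * pow x n
  pow-+ x zero    n = sym (*-identityˡ _)
  pow-+ x (suc m) n = trans (*-congˡ (pow-+ x m n)) (sym (*-assoc _ _ _))

  pow-* : ∀ x y n → pow (x * y) n ≈ pow x n * pow y n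
  pow-* x y zero    = sym (*-identityˡ 1#)
  pow-* x y (suc n) =
    trans (*-congˡ (pow-* x y n)) (solve 4 (λ a b c d → (a :* b) :* (c :* d) := (a :* c) :* (b :* d)) refl _ _ _ _)

  Cancellable : Carrier → Set (c ⊔ ℓ)
  Cancellable x = ∀ y z → x * y ≈ x * z → y ≈ z

  cancellable-* : ∀ {x y} → Cancellable x → Cancellable y → Cancellable (x * y)
  cancellable-* {x} {y} x-canc y-canc u v xyu≈xyv =
    y-canc u v (x-canc (y * u) (y * v) (trans (sym (*-assoc x y u)) (trans xyu≈xyv (*-assoc x y v))))

  cancellable-prodFin : ∀ n (f : Fin n → Carrier) → (∀ i → Cancellable (f i)) → Cancellable (prodFin n f)
  cancellable-prodFin zero    f canc u v 1u≈1v = trans (sym (*-identityˡ u)) (trans 1u≈1v (*-identityˡ v))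
  cancellable-prodFin (suc n) f canc = cancellable-* (canc zero) (cancellable-prodFin n _ (λ i → canc (suc i)))

module Determinant {c ℓ : Level} (R : CommutativeRing c ℓ) where
  open CommutativeRing R hiding (zero)
  open RingDefs R
  open IntegerCoefficientSolver R
  open FiniteProducts R
  open import Relation.Binary.Reasoning.Setoid setoid

  Matrix : ℕ → Set c
  Matrix n = Fin n → Fin n → Carrier

  minor : ∀ {n} → Matrix (suc n) → Fin (suc n) → Matrix n
  minor A j i k = A (suc i) (punchIn j k)

  sign : ∀ {n} → Fin n → Carrier
  sign j = pow (- 1#) (toℕ j)

  expansionTerm : ∀ {n} → Matrix (suc n) → Fin (suc n) → Carrier
  expansionTerm {n} A j = sign j * (A zero j * det n (minor A j))

  det-cong : ∀ n {A B : Matrix n} → (∀ i j → A i j ≈ B i j) → det n A ≈ det n B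
  det-cong zero    A≈B = refl
  det-cong (suc n) A≈B = sumFin-cong (suc n) (λ j →
    *-congˡ {sign j} (*-cong (A≈B zero j) (det-cong n (λ i k → A≈B (suc i) (punchIn j k)))))

  det-linear : ∀ n (A B B′ : Matrix n) j x y →
    (∀ i k → k ≢ j → A i k ≈ B i k) → (∀ i k → k ≢ j → A i k ≈ B′ i k) →
    (∀ i → A i j ≈ x * B i j + y * B′ i j) → det n A ≈ x * det n B + y * det n B′
  det-linear (suc n) A B B′ j x y A≈B A≈B′ Aj≈ =
    trans (sumFin-cong (suc n) term) (sumFin-linear (suc n) x y (expansionTerm B) (expansionTerm B′))
    where
    term : ∀ j₀ → expansionTerm A j₀ ≈ x * expansionTerm B j₀ + y * expansionTerm B′ j₀
    term j₀ with j₀ Fin.≟ j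
    ... | yes ≡.refl = begin
      sign j₀ * (A zero j₀ * det n (minor A j₀))
        ≈⟨ *-congˡ (*-congʳ (Aj≈ zero)) ⟩
      sign j₀ * ((x * B zero j₀ + y * B′ zero j₀) * det n (minor A j₀))
        ≈⟨ solve 6 (λ s x y b c d → s :* ((x :* b :+ y :* c) :* d) := x :* (s :* (b :* d)) :+ y :* (s :* (c :* d)))
                 refl _ x y _ _ _ ⟩
      x * (sign j₀ * (B zero j₀ * det n (minor A j₀))) + y * (sign j₀ * (B′ zero j₀ * det n (minor A j₀)))
        ≈⟨ +-cong (*-congˡ (*-congˡ (*-congˡ (minor-agrees A≈B))))
                  (*-congˡ (*-congˡ (*-congˡ (minor-agrees A≈B′)))) ⟩
      x * expansionTerm B j₀ + y * expansionTerm B′ j₀ ∎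
      where
      minor-agrees : ∀ {D} → (∀ i k → k ≢ j₀ → A i k ≈ D i k) → det n (minor A j₀) ≈ det n (minor D j₀)
      minor-agrees A≈D = det-cong n (λ i k → A≈D (suc i) (punchIn j₀ k) (FinP.punchInᵢ≢i j₀ k))
    ... | no j₀≢j = begin
      sign j₀ * (A zero j₀ * det n (minor A j₀))
        ≈⟨ *-congˡ (*-congˡ minor-linear) ⟩
      sign j₀ * (A zero j₀ * (x * det n (minor B j₀) + y * det n (minor B′ j₀)))
        ≈⟨ solve 6 (λ s x y a b c → s :* (a :* (x :* b :+ y :* c)) := x :* (s :* (a :* b)) :+ y :* (s :* (a :* c)))
                 refl _ x y _ _ _ ⟩
      x * (sign j₀ * (A zero j₀ * det n (minor B j₀))) + y * (sign j₀ * (A zero j₀ * det n (minor B′ j₀)))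
        ≈⟨ +-cong (*-congˡ (*-congˡ (*-congʳ (A≈B zero j₀ j₀≢j)))) (*-congˡ (*-congˡ (*-congʳ (A≈B′ zero j₀ j₀≢j)))) ⟩
      x * expansionTerm B j₀ + y * expansionTerm B′ j₀ ∎
      where
      j′ : Fin n
      j′ = punchOut j₀≢j
      punchIn-j′ : punchIn j₀ j′ ≡ j
      punchIn-j′ = FinP.punchIn-punchOut j₀≢j
      off-j′ : ∀ k → k ≢ j′ → punchIn j₀ k ≢ j
      off-j′ k k≢j′ eq = k≢j′ (FinP.punchIn-injective j₀ k j′ (≡.trans eq (≡.sym punchIn-j′)))
      minor-linear : det n (minor A j₀) ≈ x * det n (minor B j₀) + y * det n (minor B′ j₀)
      minor-linear = det-linear n (minor A j₀) (minor B j₀) (minor B′ j₀) j′ x y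
        (λ i k k≢ → A≈B (suc i) (punchIn j₀ k) (off-j′ k k≢))
        (λ i k k≢ → A≈B′ (suc i) (punchIn j₀ k) (off-j′ k k≢))
        (λ i → ≡.subst (λ k → A (suc i) k ≈ x * B (suc i) k + y * B′ (suc i) k) (≡.sym punchIn-j′) (Aj≈ (suc i)))

  private
    punchIn-adjacent : ∀ {n} (g : Fin (suc (suc n)) → Carrier) (j : Fin (suc n)) → g (inject₁ j) ≈ g (suc j) →
      ∀ k → g (punchIn (inject₁ j) k) ≈ g (punchIn (suc j) k)
    punchIn-adjacent g zero    g≈ zero    = sym g≈
    punchIn-adjacent g zero    g≈ (suc k) = refl
    punchIn-adjacent g (suc j) g≈ zero    = refl
    punchIn-adjacent {suc n} g (suc j) g≈ (suc k) = punchIn-adjacent (λ i → g (suc i)) j g≈ k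

    punchIn-keeps-adjacent : ∀ {n} (j : Fin (suc n)) (j₀ : Fin (suc (suc n))) → j₀ ≢ inject₁ j → j₀ ≢ suc j →
      Σ (Fin n) λ j′ → punchIn j₀ (inject₁ j′) ≡ inject₁ j × punchIn j₀ (suc j′) ≡ suc j
    punchIn-keeps-adjacent zero    zero             j₀≢ j₀≢′ = ⊥-elim (j₀≢ ≡.refl)
    punchIn-keeps-adjacent (suc j) zero             j₀≢ j₀≢′ = j , ≡.refl , ≡.refl
    punchIn-keeps-adjacent zero    (suc zero)       j₀≢ j₀≢′ = ⊥-elim (j₀≢′ ≡.refl)
    punchIn-keeps-adjacent {suc n} zero (suc (suc j₀)) j₀≢ j₀≢′ = zero , ≡.refl , ≡.refl
    punchIn-keeps-adjacent {suc n} (suc j) (suc j₀) j₀≢ j₀≢′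
      with punchIn-keeps-adjacent j j₀ (λ eq → j₀≢ (≡.cong suc eq)) (λ eq → j₀≢′ (≡.cong suc eq))
    ... | j′ , eq , eq′ = suc j′ , ≡.cong suc eq , ≡.cong suc eq′

  det-adjacent-columns : ∀ n (A : Matrix (suc n)) j → (∀ i → A i (inject₁ j) ≈ A i (suc j)) → det (suc n) A ≈ 0#
  -- Expand along the first row: the other minors still have two equal adjacent columns, and the
  -- terms of columns j and j + 1 have equal minors but opposite signs.
  det-adjacent-columns (suc n) A j cols≈ = sumFin-adjacent-pair (suc n) (expansionTerm A) j other-zero pair-cancels
    where
    other-zero : ∀ j₀ → j₀ ≢ inject₁ j → j₀ ≢ suc j → expansionTerm A j₀ ≈ 0#
    other-zero j₀ j₀≢ j₀≢′ with punchIn-keeps-adjacent j j₀ j₀≢ j₀≢′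
    ... | j′ , eq , eq′ = trans (*-congˡ (trans (*-congˡ minor≈0) (zeroʳ _))) (zeroʳ _)
      where
      minor≈0 : det (suc n) (minor A j₀) ≈ 0#
      minor≈0 = det-adjacent-columns n (minor A j₀) j′
        (λ i → ≡.subst₂ (λ k k′ → A (suc i) k ≈ A (suc i) k′) (≡.sym eq) (≡.sym eq′) (cols≈ (suc i)))
    pair-cancels : expansionTerm A (inject₁ j) + expansionTerm A (suc j) ≈ 0#
    pair-cancels = begin
      sign (inject₁ j) * (A zero (inject₁ j) * det (suc n) (minor A (inject₁ j)))
        + (- 1# * sign j) * (A zero (suc j) * det (suc n) (minor A (suc j)))
        ≈⟨ +-congʳ (*-cong (reflexive (≡.cong (pow (- 1#)) (FinP.toℕ-inject₁ j)))
                           (*-cong (cols≈ zero) (det-cong (suc n) (λ i → punchIn-adjacent (A (suc i)) j (cols≈ (suc i)))))) ⟩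
      sign j * (A zero (suc j) * det (suc n) (minor A (suc j)))
        + (- 1# * sign j) * (A zero (suc j) * det (suc n) (minor A (suc j)))
        ≈⟨ solve 3 (λ s a d → s :* (a :* d) :+ (:- con (+ 1) :* s) :* (a :* d) := con (+ 0)) refl _ _ _ ⟩
      0# ∎

  det-column-operation : ∀ n (A B : Matrix (suc n)) j x y →
    (∀ i k → k ≢ suc j → B i k ≈ A i k) → (∀ i → B i (suc j) ≈ x * A i (suc j) - y * A i (inject₁ j)) →
    det (suc n) B ≈ x * det (suc n) A
  det-column-operation n A B j x y B≈A Bj≈ = begin
    det (suc n) B                             ≈⟨ det-linear (suc n) B A A′ (suc j) x (- y) B≈A B≈A′ Bj≈′ ⟩
    x * det (suc n) A + - y * det (suc n) A′  ≈⟨ +-congˡ (trans (*-congˡ detA′≈0) (zeroʳ _)) ⟩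
    x * det (suc n) A + 0#                    ≈⟨ +-identityʳ _ ⟩
    x * det (suc n) A                         ∎
    where
    A′ : Matrix (suc n)
    A′ i k with k Fin.≟ suc j
    ... | yes _ = A i (inject₁ j)
    ... | no _  = A i k
    B≈A′ : ∀ i k → k ≢ suc j → B i k ≈ A′ i k
    B≈A′ i k k≢ with k Fin.≟ suc j
    ... | yes k≡ = ⊥-elim (k≢ k≡)
    ... | no _   = B≈A i k k≢
    A′-suc : ∀ i → A′ i (suc j) ≈ A i (inject₁ j)
    A′-suc i with suc j Fin.≟ suc j
    ... | yes _ = refl
    ... | no ≢  = ⊥-elim (≢ ≡.refl)
    A′-inject : ∀ i → A′ i (inject₁ j) ≈ A i (inject₁ j)
    A′-inject i with inject₁ j Fin.≟ suc j
    ... | yes eq = ⊥-elim (ℕP.1+n≢n (≡.trans (≡.sym (≡.cong toℕ eq)) (FinP.toℕ-inject₁ j)))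
    ... | no _   = refl
    Bj≈′ : ∀ i → B i (suc j) ≈ x * A i (suc j) + - y * A′ i (suc j)
    Bj≈′ i = trans (Bj≈ i) (+-congˡ (trans (solve 2 (λ a b → :- (a :* b) := :- a :* b) refl y _) (*-congˡ (sym (A′-suc i)))))
    detA′≈0 : det (suc n) A′ ≈ 0#
    detA′≈0 = det-adjacent-columns n A′ j (λ i → trans (A′-inject i) (sym (A′-suc i)))

  det-first-row : ∀ n (A : Matrix (suc n)) → (∀ j → A zero (suc j) ≈ 0#) →
    det (suc n) A ≈ A zero zero * det n (λ i j → A (suc i) (suc j))
  det-first-row n A row≈0 = begin
    1# * (A zero zero * det n (minor A zero)) + sumFin n (λ j → expansionTerm A (suc j))
      ≈⟨ +-cong (*-identityˡ _) (sumFin-zero n _ (λ j → trans (*-congˡ (trans (*-congʳ (row≈0 j)) (zeroˡ _))) (zeroʳ _))) ⟩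
    A zero zero * det n (minor A zero) + 0#          ≈⟨ +-identityʳ _ ⟩
    A zero zero * det n (λ i j → A (suc i) (suc j))  ∎

  det-scale-rows : ∀ n (r : Fin n → Carrier) A → det n (λ i j → r i * A i j) ≈ prodFin n r * det n A
  det-scale-rows zero    r A = sym (*-identityʳ 1#)
  det-scale-rows (suc n) r A = trans (sumFin-cong (suc n) term) (sumFin-*ˡ (suc n) (prodFin (suc n) r) (expansionTerm A))
    where
    term : ∀ j → sign j * ((r zero * A zero j) * det n (λ i k → r (suc i) * minor A j i k))
                 ≈ prodFin (suc n) r * expansionTerm A j
    term j = trans (*-congˡ (*-congˡ (det-scale-rows n (λ i → r (suc i)) (minor A j))))
                   (solve 5 (λ s r₀ a p d → s :* ((r₀ :* a) :* (p :* d)) := (r₀ :* p) :* (s :* (a :* d))) refl _ _ _ _ _)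

  det-scale-columns : ∀ n (s : Fin n → Carrier) A → det n (λ i j → s j * A i j) ≈ prodFin n s * det n A
  det-scale-columns zero    s A = sym (*-identityʳ 1#)
  det-scale-columns (suc n) s A = trans (sumFin-cong (suc n) term) (sumFin-*ˡ (suc n) (prodFin (suc n) s) (expansionTerm A))
    where
    term : ∀ j → sign j * ((s j * A zero j) * det n (λ i k → s (punchIn j k) * minor A j i k))
                 ≈ prodFin (suc n) s * expansionTerm A j
    term j = trans (*-congˡ (*-congˡ (det-scale-columns n (λ k → s (punchIn j k)) (minor A j))))
             (trans (solve 5 (λ σ sj a p d → σ :* ((sj :* a) :* (p :* d)) := (sj :* p) :* (σ :* (a :* d))) refl _ _ _ _ _)
                    (*-congʳ (sym (prodFin-punchIn n s j))))

module BooleanComparison where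

  ≤ᵇ-refl : ∀ a → (a ≤ᵇ a) ≡ true
  ≤ᵇ-refl zero          = ≡.refl
  ≤ᵇ-refl (suc zero)    = ≡.refl
  ≤ᵇ-refl (suc (suc a)) = ≤ᵇ-refl (suc a)

  <ᵇ-irrefl : ∀ a → (a <ᵇ a) ≡ false
  <ᵇ-irrefl zero    = ≡.refl
  <ᵇ-irrefl (suc a) = <ᵇ-irrefl a

  1+a<ᵇa : ∀ a → (suc a <ᵇ a) ≡ false
  1+a<ᵇa zero    = ≡.refl
  1+a<ᵇa (suc a) = 1+a<ᵇa a

  <ᵇ-suc : ∀ a b → (a <ᵇ suc b) ≡ (a ≤ᵇ b)
  <ᵇ-suc zero    b = ≡.refl
  <ᵇ-suc (suc a) b = ≡.refl

  ≤ᵇ≡<ᵇ : ∀ a b → a ≢ b → (a ≤ᵇ b) ≡ (a <ᵇ b)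
  ≤ᵇ≡<ᵇ zero    zero    a≢b = ⊥-elim (a≢b ≡.refl)
  ≤ᵇ≡<ᵇ zero    (suc b) a≢b = ≡.refl
  ≤ᵇ≡<ᵇ (suc a) zero    a≢b = ≡.refl
  ≤ᵇ≡<ᵇ (suc a) (suc b) a≢b = ≡.trans (<ᵇ-suc a b) (≤ᵇ≡<ᵇ a b (λ eq → a≢b (≡.cong suc eq)))

  <ᵇ-suc≡<ᵇ : ∀ a b → a ≢ b → (a <ᵇ suc b) ≡ (a <ᵇ b)
  <ᵇ-suc≡<ᵇ a b a≢b = ≡.trans (<ᵇ-suc a b) (≤ᵇ≡<ᵇ a b a≢b)

  n<ᵇ1+toℕ : ∀ {n} (j : Fin n) → (n <ᵇ suc (toℕ j)) ≡ false
  n<ᵇ1+toℕ {suc n} zero    = ≡.refl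
  n<ᵇ1+toℕ {suc n} (suc j) = n<ᵇ1+toℕ j

  n<ᵇtoℕ : ∀ {n} (j : Fin (suc n)) → (n <ᵇ toℕ j) ≡ false
  n<ᵇtoℕ         zero    = ≡.refl
  n<ᵇtoℕ {suc n} (suc j) = n<ᵇtoℕ j

  toℕ-≢ : ∀ {n} {i j : Fin n} → i ≢ j → toℕ i ≢ toℕ j
  toℕ-≢ i≢j eq = i≢j (FinP.toℕ-injective eq)

module LinearForms {c ℓ : Level} (R : CommutativeRing c ℓ) where
  open CommutativeRing R hiding (zero)
  open RingDefs R
  open IntegerCoefficientSolver R
  open FiniteProducts R
  open Determinant R
  open BooleanComparison
  open import Relation.Binary.Reasoning.Setoid setoid

  Point : Set c
  Point = Carrier × Carrier

  infix 8 _·_ _∧_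
  infix 4 _≈ₚ_

  _·_ : Point → Point → Carrier
  (l₁ , l₂) · (x₁ , x₂) = l₁ * x₁ + l₂ * x₂

  _∧_ : Point → Point → Carrier
  (u₁ , u₂) ∧ (x₁ , x₂) = u₁ * x₂ - u₂ * x₁

  _≈ₚ_ : Point → Point → Set ℓ
  (u₁ , u₂) ≈ₚ (x₁ , x₂) = (u₁ ≈ x₁) × (u₂ ≈ x₂)

  formProduct : ∀ m (L M : Fin m → Point) → ℕ → Point → Carrier
  formProduct m L M j x = prodFin m (λ t → if j ≤ᵇ toℕ t then L t · x else 1#)
                        * prodFin m (λ t → if toℕ t <ᵇ j then M t · x else 1#)

  formMatrix : ∀ m (v : Fin (suc m) → Point) (L M : Fin m → Point) → Matrix (suc m)
  formMatrix m v L M i j = formProduct m L M (toℕ j) (v i)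

  bracketVandermonde : ∀ n → (Fin n → Point) → Carrier
  bracketVandermonde zero    v = 1#
  bracketVandermonde (suc n) v = prodFin n (λ i → v zero ∧ v (suc i)) * bracketVandermonde n (λ i → v (suc i))

  upperProduct : ∀ m → (Fin m → Fin m → Carrier) → Carrier
  upperProduct m X = prodFin m (λ j → prodFin m (λ i → if toℕ i ≤ᵇ toℕ j then X i j else 1#))

  if-congˡ : ∀ b {x y} → x ≈ y → (if b then x else 1#) ≈ (if b then y else 1#)
  if-congˡ true  x≈y = x≈y
  if-congˡ false x≈y = refl

  if-congʳ : ∀ {b b′} x → b ≡ b′ → (if b then x else 1#) ≈ (if b′ then x else 1#)
  if-congʳ x b≡b′ = reflexive (≡.cong (λ β → if β then x else 1#) b≡b′)

  ·-cong : ∀ {l l′ x x′} → l ≈ₚ l′ → x ≈ₚ x′ → l · x ≈ l′ · x′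
  ·-cong (l₁≈ , l₂≈) (x₁≈ , x₂≈) = +-cong (*-cong l₁≈ x₁≈) (*-cong l₂≈ x₂≈)

  ∧-cong : ∀ {u u′ x x′} → u ≈ₚ u′ → x ≈ₚ x′ → u ∧ x ≈ u′ ∧ x′
  ∧-cong (u₁≈ , u₂≈) (x₁≈ , x₂≈) = +-cong (*-cong u₁≈ x₂≈) (-‿cong (*-cong u₂≈ x₁≈))

  formProduct-cong : ∀ m {L L′ M M′ : Fin m → Point} j {x x′} →
    (∀ t → L t ≈ₚ L′ t) → (∀ t → M t ≈ₚ M′ t) → x ≈ₚ x′ → formProduct m L M j x ≈ formProduct m L′ M′ j x′
  formProduct-cong m j L≈ M≈ x≈ =
    *-cong (prodFin-cong m (λ t → if-congˡ _ (·-cong (L≈ t) x≈))) (prodFin-cong m (λ t → if-congˡ _ (·-cong (M≈ t) x≈)))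

  bracketVandermonde-cong : ∀ n {v v′ : Fin n → Point} → (∀ i → v i ≈ₚ v′ i) →
    bracketVandermonde n v ≈ bracketVandermonde n v′
  bracketVandermonde-cong zero    v≈ = refl
  bracketVandermonde-cong (suc n) v≈ =
    *-cong (prodFin-cong n (λ i → ∧-cong (v≈ zero) (v≈ (suc i)))) (bracketVandermonde-cong n (λ i → v≈ (suc i)))

  upperProduct-cong : ∀ m {X Y : Fin m → Fin m → Carrier} → (∀ i j → X i j ≈ Y i j) → upperProduct m X ≈ upperProduct m Y
  upperProduct-cong m X≈Y = prodFin-cong m (λ j → prodFin-cong m (λ i → if-congˡ _ (X≈Y i j)))

  upperProduct-suc : ∀ m (X : Fin (suc m) → Fin (suc m) → Carrier) →
    upperProduct (suc m) X ≈ prodFin (suc m) (λ j → X j j) * upperProduct m (λ i j → X (inject₁ i) (suc j))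
  upperProduct-suc m X = begin
    upperProduct (suc m) X
      ≈⟨ prodFin-cong (suc m) (λ j → prodFin-if-extract (suc m) (λ i → toℕ i ≤ᵇ toℕ j) (λ i → toℕ i <ᵇ toℕ j) (λ i → X i j) j
                        (≤ᵇ-refl (toℕ j)) (<ᵇ-irrefl (toℕ j)) (λ i i≢j → ≤ᵇ≡<ᵇ (toℕ i) (toℕ j) (toℕ-≢ i≢j))) ⟩
    prodFin (suc m) (λ j → X j j * strictlyAbove j)           ≈⟨ prodFin-* (suc m) (λ j → X j j) strictlyAbove ⟩
    prodFin (suc m) (λ j → X j j) * prodFin (suc m) strictlyAbove
      ≈⟨ *-congˡ (trans (*-cong (prodFin-ones (suc m) _ (λ i → refl)) (prodFin-cong m strictlyAbove-suc)) (*-identityˡ _)) ⟩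
    prodFin (suc m) (λ j → X j j) * upperProduct m (λ i j → X (inject₁ i) (suc j)) ∎
    where
    strictlyAbove : Fin (suc m) → Carrier
    strictlyAbove j = prodFin (suc m) (λ i → if toℕ i <ᵇ toℕ j then X i j else 1#)
    strictlyAbove-suc : ∀ j → strictlyAbove (suc j) ≈ prodFin m (λ i → if toℕ i ≤ᵇ toℕ j then X (inject₁ i) (suc j) else 1#)
    strictlyAbove-suc j = begin
      strictlyAbove (suc j)
        ≈⟨ prodFin-init-last m (λ i → if toℕ i <ᵇ suc (toℕ j) then X i (suc j) else 1#) ⟩
      prodFin m (λ i → if toℕ (inject₁ i) <ᵇ suc (toℕ j) then X (inject₁ i) (suc j) else 1#)
        * (if toℕ (fromℕ m) <ᵇ suc (toℕ j) then X (fromℕ m) (suc j) else 1#)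
        ≈⟨ *-cong (prodFin-cong m (λ i → if-congʳ _ (≡.trans (≡.cong (_<ᵇ suc (toℕ j)) (FinP.toℕ-inject₁ i))
                                                             (<ᵇ-suc (toℕ i) (toℕ j)))))
                  (if-congʳ _ (≡.trans (≡.cong (_<ᵇ suc (toℕ j)) (FinP.toℕ-fromℕ m)) (n<ᵇ1+toℕ j))) ⟩
      prodFin m (λ i → if toℕ i ≤ᵇ toℕ j then X (inject₁ i) (suc j) else 1#) * 1#  ≈⟨ *-identityʳ _ ⟩
      prodFin m (λ i → if toℕ i ≤ᵇ toℕ j then X (inject₁ i) (suc j) else 1#)       ∎

  -- The factors shared by columns j and j+1 of the form matrix.
  formProductWithout : ∀ m (L M : Fin m → Point) → Fin m → Point → Carrier
  formProductWithout m L M j x = prodFin m (λ t → if toℕ j <ᵇ toℕ t then L t · x else 1#)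
                               * prodFin m (λ t → if toℕ t <ᵇ toℕ j then M t · x else 1#)

  formProduct-at : ∀ m (L M : Fin m → Point) j x → formProduct m L M (toℕ j) x ≈ L j · x * formProductWithout m L M j x
  formProduct-at m L M j x =
    trans (*-congʳ (prodFin-if-extract m (λ t → toℕ j ≤ᵇ toℕ t) (λ t → toℕ j <ᵇ toℕ t) (λ t → L t · x) j
                      (≤ᵇ-refl (toℕ j)) (<ᵇ-irrefl (toℕ j)) (λ t t≢j → ≤ᵇ≡<ᵇ (toℕ j) (toℕ t) (toℕ-≢ (λ eq → t≢j (≡.sym eq))))))
          (*-assoc _ _ _)

  formProduct-after : ∀ m (L M : Fin m → Point) j x → formProduct m L M (suc (toℕ j)) x ≈ M j · x * formProductWithout m L M j x
  formProduct-after m L M j x =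
    trans (*-congˡ (prodFin-if-extract m (λ t → toℕ t <ᵇ suc (toℕ j)) (λ t → toℕ t <ᵇ toℕ j) (λ t → M t · x) j
                      (≡.trans (<ᵇ-suc (toℕ j) (toℕ j)) (≤ᵇ-refl (toℕ j))) (<ᵇ-irrefl (toℕ j))
                      (λ t t≢j → <ᵇ-suc≡<ᵇ (toℕ t) (toℕ j) (toℕ-≢ t≢j))))
          (solve 3 (λ a b c → a :* (b :* c) := b :* (a :* c)) refl _ _ _)

  formProductWithout-shift : ∀ m (L M : Fin (suc m) → Point) j x →
    formProductWithout (suc m) L M j x ≈ formProduct m (λ t → L (suc t)) (λ t → M (inject₁ t)) (toℕ j) x
  formProductWithout-shift m L M j x = *-cong dropFirst dropLast
    where
    dropFirst : prodFin (suc m) (λ t → if toℕ j <ᵇ toℕ t then L t · x else 1#)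
                ≈ prodFin m (λ t → if toℕ j ≤ᵇ toℕ t then L (suc t) · x else 1#)
    dropFirst = trans (*-identityˡ _) (prodFin-cong m (λ t → if-congʳ _ (<ᵇ-suc (toℕ j) (toℕ t))))
    dropLast : prodFin (suc m) (λ t → if toℕ t <ᵇ toℕ j then M t · x else 1#)
               ≈ prodFin m (λ t → if toℕ t <ᵇ toℕ j then M (inject₁ t) · x else 1#)
    dropLast = trans (prodFin-init-last m (λ t → if toℕ t <ᵇ toℕ j then M t · x else 1#))
      (trans (*-cong (prodFin-cong m (λ t → if-congʳ _ (≡.cong (_<ᵇ toℕ j) (FinP.toℕ-inject₁ t))))
                     (if-congʳ _ (≡.trans (≡.cong (_<ᵇ toℕ j) (FinP.toℕ-fromℕ m)) (n<ᵇtoℕ j))))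
             (*-identityʳ _))

module FormDeterminantCancellative {c ℓ : Level} (R : CommutativeRing c ℓ) where
  open CommutativeRing R hiding (zero)
  open RingDefs R
  open IntegerCoefficientSolver R
  open FiniteProducts R
  open Determinant R
  open LinearForms R
  open BooleanComparison
  open import Relation.Binary.Reasoning.Setoid setoid

  ·-exchange : ∀ l m a x → l · a * m · x - m · a * l · x ≈ l ∧ m * a ∧ x
  ·-exchange (l₁ , l₂) (m₁ , m₂) (a₁ , a₂) (x₁ , x₂) =
    solve 8 (λ l₁ l₂ m₁ m₂ a₁ a₂ x₁ x₂ →
               (l₁ :* a₁ :+ l₂ :* a₂) :* (m₁ :* x₁ :+ m₂ :* x₂) :- (m₁ :* a₁ :+ m₂ :* a₂) :* (l₁ :* x₁ :+ l₂ :* x₂)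
               := (l₁ :* m₂ :- l₂ :* m₁) :* (a₁ :* x₂ :- a₂ :* x₁))
            refl l₁ l₂ m₁ m₂ a₁ a₂ x₁ x₂

  -- Subtracting (M_j · v₀) column j from (L_j · v₀) column j + 1, right to left so that column j is
  -- still the original one, clears the first row; the remaining minor is (L_j ∧ M_j)(v₀ ∧ v_{i+1})
  -- times the form matrix of the data with v₀, L₀ and M_last removed.
  module Elimination {m′} (v : Fin (suc (suc m′)) → Point) (L M : Fin (suc m′) → Point) where
    m : ℕ
    m = suc m′

    K : Matrix (suc m)
    K = formMatrix m v L M

    λ₀ μ₀ : Fin m → Carrier
    λ₀ j = L j · v zero
    μ₀ j = M j · v zero

    eliminated : ℕ → Matrix (suc m)
    eliminated r i zero    = K i zero
    eliminated r i (suc j) = if r ≤ᵇ toℕ j then λ₀ j * K i (suc j) - μ₀ j * K i (inject₁ j) else K i (suc j)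

    eliminationFactor : ℕ → Carrier
    eliminationFactor r = prodFin m (λ t → if r ≤ᵇ toℕ t then λ₀ t else 1#)

    private
      eliminated-if : ∀ {b b′} i j → b ≡ b′ →
        (if b then λ₀ j * K i (suc j) - μ₀ j * K i (inject₁ j) else K i (suc j))
        ≈ (if b′ then λ₀ j * K i (suc j) - μ₀ j * K i (inject₁ j) else K i (suc j))
      eliminated-if i j b≡b′ =
        reflexive (≡.cong (λ β → if β then λ₀ j * K i (suc j) - μ₀ j * K i (inject₁ j) else K i (suc j)) b≡b′)

    det-eliminated : ∀ d r → d ℕ.+ r ≡ m → det (suc m) (eliminated r) ≈ eliminationFactor r * det (suc m) K
    det-eliminated zero r ≡.refl = begin
      det (suc m) (eliminated m)           ≈⟨ det-cong (suc m) nothing-eliminated ⟩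
      det (suc m) K                        ≈⟨ sym (*-identityˡ _) ⟩
      1# * det (suc m) K                   ≈⟨ *-congʳ (sym (prodFin-ones m _ (λ t → if-congʳ (λ₀ t) (n<ᵇtoℕ t)))) ⟩
      eliminationFactor m * det (suc m) K  ∎
      where
      nothing-eliminated : ∀ i k → eliminated m i k ≈ K i k
      nothing-eliminated i zero    = refl
      nothing-eliminated i (suc j) = eliminated-if i j (n<ᵇtoℕ j)
    det-eliminated (suc d) r d+r≡m = begin
      det (suc m) (eliminated r)
        ≈⟨ det-column-operation m (eliminated (suc r)) (eliminated r) j₀ (λ₀ j₀) (μ₀ j₀) other-columns column-j₀ ⟩
      λ₀ j₀ * det (suc m) (eliminated (suc r))
        ≈⟨ *-congˡ (det-eliminated d (suc r) (≡.trans (ℕP.+-suc d r) d+r≡m)) ⟩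
      λ₀ j₀ * (eliminationFactor (suc r) * det (suc m) K) ≈⟨ sym (*-assoc _ _ _) ⟩
      (λ₀ j₀ * eliminationFactor (suc r)) * det (suc m) K
        ≈⟨ *-congʳ (sym (prodFin-if-extract m (λ t → r ≤ᵇ toℕ t) (λ t → suc r ≤ᵇ toℕ t) λ₀ j₀ r≤ᵇj₀ r<ᵇj₀ ≤ᵇ-off-j₀)) ⟩
      eliminationFactor r * det (suc m) K ∎
      where
      r<m : r ℕ.< m
      r<m = ≡.subst (suc r ℕ.≤_) (≡.trans (ℕP.+-suc d r) d+r≡m) (ℕP.m≤n+m (suc r) d)
      j₀ : Fin m
      j₀ = Fin.fromℕ< r<m
      toℕ-j₀ : toℕ j₀ ≡ r
      toℕ-j₀ = FinP.toℕ-fromℕ< r<m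
      r≤ᵇj₀ : (r ≤ᵇ toℕ j₀) ≡ true
      r≤ᵇj₀ = ≡.trans (≡.cong (r ≤ᵇ_) toℕ-j₀) (≤ᵇ-refl r)
      r<ᵇj₀ : (r <ᵇ toℕ j₀) ≡ false
      r<ᵇj₀ = ≡.trans (≡.cong (r <ᵇ_) toℕ-j₀) (<ᵇ-irrefl r)
      ≤ᵇ-off-j₀ : ∀ t → t ≢ j₀ → (r ≤ᵇ toℕ t) ≡ (r <ᵇ toℕ t)
      ≤ᵇ-off-j₀ t t≢j₀ = ≤ᵇ≡<ᵇ r (toℕ t) (λ eq → t≢j₀ (FinP.toℕ-injective (≡.trans (≡.sym eq) (≡.sym toℕ-j₀))))
      other-columns : ∀ i k → k ≢ suc j₀ → eliminated r i k ≈ eliminated (suc r) i k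
      other-columns i zero    k≢ = refl
      other-columns i (suc j) k≢ = eliminated-if i j (≤ᵇ-off-j₀ j (λ eq → k≢ (≡.cong suc eq)))
      column-j₀-unchanged : ∀ i → eliminated (suc r) i (suc j₀) ≈ K i (suc j₀)
      column-j₀-unchanged i = eliminated-if i j₀ r<ᵇj₀
      column-before-unchanged : ∀ i (j : Fin m) → toℕ j ≡ r → eliminated (suc r) i (inject₁ j) ≈ K i (inject₁ j)
      column-before-unchanged i zero     _     = refl
      column-before-unchanged i (suc j′) toℕ≡r = eliminated-if i (inject₁ j′)
        (≡.trans (≡.cong (suc r ≤ᵇ_) (FinP.toℕ-inject₁ j′))
                 (≡.trans (≡.cong (λ n → suc n ≤ᵇ toℕ j′) (≡.sym toℕ≡r)) (1+a<ᵇa (toℕ j′))))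
      column-j₀ : ∀ i → eliminated r i (suc j₀)
                        ≈ λ₀ j₀ * eliminated (suc r) i (suc j₀) - μ₀ j₀ * eliminated (suc r) i (inject₁ j₀)
      column-j₀ i = trans (eliminated-if i j₀ r≤ᵇj₀)
        (+-cong (*-congˡ (sym (column-j₀-unchanged i))) (-‿cong (*-congˡ (sym (column-before-unchanged i j₀ toℕ-j₀)))))

    K′ : Matrix m
    K′ = formMatrix m′ (λ i → v (suc i)) (λ t → L (suc t)) (λ t → M (inject₁ t))

    eliminated-corner : eliminated 0 zero zero ≈ prodFin m λ₀
    eliminated-corner = trans (*-congˡ (prodFin-ones m _ (λ t → refl))) (*-identityʳ _)

    private
      K-at : ∀ i j → K i (inject₁ j) ≈ L j · v i * formProductWithout m L M j (v i)
      K-at i j = trans (reflexive (≡.cong (λ n → formProduct m L M n (v i)) (FinP.toℕ-inject₁ j))) (formProduct-at m L M j (v i))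

    eliminated-first-row : ∀ j → eliminated 0 zero (suc j) ≈ 0#
    eliminated-first-row j =
      trans (+-cong (*-congˡ (formProduct-after m L M j (v zero))) (-‿cong (*-congˡ (K-at zero j))))
            (solve 3 (λ l u w → l :* (u :* w) :- u :* (l :* w) := con (+ 0)) refl (λ₀ j) (μ₀ j) _)

    eliminated-minor : ∀ i j → eliminated 0 (suc i) (suc j) ≈ L j ∧ M j * (v zero ∧ v (suc i) * K′ i j)
    eliminated-minor i j = begin
      λ₀ j * K (suc i) (suc j) - μ₀ j * K (suc i) (inject₁ j)
        ≈⟨ +-cong (*-congˡ (formProduct-after m L M j (v (suc i)))) (-‿cong (*-congˡ (K-at (suc i) j))) ⟩
      λ₀ j * (M j · v (suc i) * W) - μ₀ j * (L j · v (suc i) * W)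
        ≈⟨ solve 5 (λ a b c d w → a :* (b :* w) :- c :* (d :* w) := (a :* b :- c :* d) :* w) refl _ _ _ _ W ⟩
      (λ₀ j * M j · v (suc i) - μ₀ j * L j · v (suc i)) * W
        ≈⟨ *-congʳ (·-exchange (L j) (M j) (v zero) (v (suc i))) ⟩
      L j ∧ M j * v zero ∧ v (suc i) * W
        ≈⟨ trans (*-assoc _ _ _) (*-congˡ (*-congˡ (formProductWithout-shift m′ L M j (v (suc i))))) ⟩
      L j ∧ M j * (v zero ∧ v (suc i) * K′ i j) ∎
      where
      W = formProductWithout m L M j (v (suc i))

  det-formMatrix-cancellative : ∀ m (v : Fin (suc m) → Point) (L M : Fin m → Point) → (∀ i t → Cancellable (L t · v i)) →
    det (suc m) (formMatrix m v L M) ≈ bracketVandermonde (suc m) v * upperProduct m (λ i j → L j ∧ M i)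
  det-formMatrix-cancellative zero v L M _ =
    solve 0 (con (+ 1) :* ((con (+ 1) :* con (+ 1)) :* con (+ 1)) :+ con (+ 0) := (con (+ 1) :* con (+ 1)) :* con (+ 1)) refl
  det-formMatrix-cancellative (suc m′) v L M canc = cancellable-prodFin m λ₀ (λ t → canc zero t) _ _ (begin
    Λ * det (suc m) K                                      ≈⟨ sym (det-eliminated m 0 (ℕP.+-identityʳ m)) ⟩
    det (suc m) (eliminated 0)                             ≈⟨ det-first-row m (eliminated 0) eliminated-first-row ⟩
    eliminated 0 zero zero * det m (λ i j → eliminated 0 (suc i) (suc j))
      ≈⟨ *-cong eliminated-corner (det-cong m eliminated-minor) ⟩
    Λ * det m (λ i j → L j ∧ M j * (v zero ∧ v (suc i) * K′ i j))
      ≈⟨ *-congˡ (trans (det-scale-columns m (λ j → L j ∧ M j) (λ i j → v zero ∧ v (suc i) * K′ i j))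
                        (*-congˡ (det-scale-rows m (λ i → v zero ∧ v (suc i)) K′))) ⟩
    Λ * (prodFin m (λ j → L j ∧ M j) * (prodFin m (λ i → v zero ∧ v (suc i)) * det m K′))
      ≈⟨ *-congˡ (*-congˡ (*-congˡ (det-formMatrix-cancellative m′ (λ i → v (suc i)) (λ t → L (suc t)) (λ t → M (inject₁ t))
                                                  (λ i t → canc (suc i) (suc t))))) ⟩
    Λ * (prodFin m (λ j → L j ∧ M j) * (prodFin m (λ i → v zero ∧ v (suc i)) * (bracketVandermonde m (λ i → v (suc i)) * D′)))
      ≈⟨ *-congˡ (solve 4 (λ b a p d → b :* (a :* (p :* d)) := (a :* p) :* (b :* d)) refl _ _ _ _) ⟩
    Λ * (bracketVandermonde (suc m) v * (prodFin m (λ j → L j ∧ M j) * D′))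
      ≈⟨ *-congˡ (*-congˡ (sym (upperProduct-suc m′ (λ i j → L j ∧ M i)))) ⟩
    Λ * (bracketVandermonde (suc m) v * upperProduct m (λ i j → L j ∧ M i)) ∎)
    where
    open Elimination v L M
    Λ = prodFin m λ₀
    D′ = upperProduct m′ (λ i j → L (suc j) ∧ M (inject₁ i))

module Polynomial {c ℓ : Level} (R : CommutativeRing c ℓ) where
  open CommutativeRing R hiding (zero)
  open IntegerCoefficientSolver R
  open import Relation.Binary.Reasoning.Setoid setoid

  -- Coefficient lists, constant term first.
  Poly : Set c
  Poly = List Carrier

  coeff : Poly → ℕ → Carrier
  coeff []      n       = 0#
  coeff (a ∷ p) zero    = a
  coeff (a ∷ p) (suc n) = coeff p n

  infix 4 _≋_
  record _≋_ (p q : Poly) : Set ℓ where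
    constructor mk≋
    field coeff-≈ : ∀ n → coeff p n ≈ coeff q n
  open _≋_

  infixl 6 _⊕_
  infixl 7 _⊗_ _⊙_
  infix 8 ⊖_

  _⊕_ : Poly → Poly → Poly
  []      ⊕ q       = q
  (a ∷ p) ⊕ []      = a ∷ p
  (a ∷ p) ⊕ (b ∷ q) = (a + b) ∷ (p ⊕ q)

  ⊖_ : Poly → Poly
  ⊖ []      = []
  ⊖ (a ∷ p) = (- a) ∷ (⊖ p)

  _⊙_ : Carrier → Poly → Poly
  a ⊙ []      = []
  a ⊙ (b ∷ p) = (a * b) ∷ (a ⊙ p)

  _⊗_ : Poly → Poly → Poly
  []      ⊗ q = []
  (a ∷ p) ⊗ q = a ⊙ q ⊕ (0# ∷ p ⊗ q)

  coeff-⊕ : ∀ p q n → coeff (p ⊕ q) n ≈ coeff p n + coeff q n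
  coeff-⊕ []      q       n       = sym (+-identityˡ _)
  coeff-⊕ (a ∷ p) []      n       = sym (+-identityʳ _)
  coeff-⊕ (a ∷ p) (b ∷ q) zero    = refl
  coeff-⊕ (a ∷ p) (b ∷ q) (suc n) = coeff-⊕ p q n

  coeff-⊖ : ∀ p n → coeff (⊖ p) n ≈ - coeff p n
  coeff-⊖ []      n       = solve 0 (con (+ 0) := :- con (+ 0)) refl
  coeff-⊖ (a ∷ p) zero    = refl
  coeff-⊖ (a ∷ p) (suc n) = coeff-⊖ p n

  coeff-⊙ : ∀ a p n → coeff (a ⊙ p) n ≈ a * coeff p n
  coeff-⊙ a []      n       = sym (zeroʳ a)
  coeff-⊙ a (b ∷ p) zero    = refl
  coeff-⊙ a (b ∷ p) (suc n) = coeff-⊙ a p n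

  coeff₀-⊗ : ∀ p q → coeff (p ⊗ q) 0 ≈ coeff p 0 * coeff q 0
  coeff₀-⊗ []      q = sym (zeroˡ _)
  coeff₀-⊗ (a ∷ p) q = trans (coeff-⊕ (a ⊙ q) (0# ∷ p ⊗ q) 0) (trans (+-identityʳ _) (coeff-⊙ a q 0))

  ≋-refl : ∀ {p} → p ≋ p
  ≋-refl = mk≋ (λ n → refl)

  ≋-sym : ∀ {p q} → p ≋ q → q ≋ p
  ≋-sym p≋q = mk≋ (λ n → sym (coeff-≈ p≋q n))

  ≋-trans : ∀ {p q r} → p ≋ q → q ≋ r → p ≋ r
  ≋-trans p≋q q≋r = mk≋ (λ n → trans (coeff-≈ p≋q n) (coeff-≈ q≋r n))

  ∷-cong : ∀ {a b p q} → a ≈ b → p ≋ q → a ∷ p ≋ b ∷ q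
  ∷-cong a≈b p≋q = mk≋ (λ { zero → a≈b ; (suc n) → coeff-≈ p≋q n })

  0∷-zero : ∀ {p} → p ≋ [] → 0# ∷ p ≋ []
  0∷-zero p≋0 = mk≋ (λ { zero → refl ; (suc n) → coeff-≈ p≋0 n })

  ∷-injectiveʳ : ∀ {a b p q} → a ∷ p ≋ b ∷ q → p ≋ q
  ∷-injectiveʳ eq = mk≋ (λ n → coeff-≈ eq (suc n))

  by-coeff : ∀ {p q} (f g : ℕ → Carrier) → (∀ n → coeff p n ≈ f n) → (∀ n → coeff q n ≈ g n) →
             (∀ n → f n ≈ g n) → p ≋ q
  by-coeff f g p≈f q≈g f≈g = mk≋ (λ n → trans (p≈f n) (trans (f≈g n) (sym (q≈g n))))

  ⊕-cong : ∀ {p p′ q q′} → p ≋ p′ → q ≋ q′ → p ⊕ q ≋ p′ ⊕ q′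
  ⊕-cong {p} {p′} {q} {q′} p≋ q≋ =
    by-coeff _ _ (coeff-⊕ p q) (coeff-⊕ p′ q′) (λ n → +-cong (coeff-≈ p≋ n) (coeff-≈ q≋ n))

  ⊖-cong : ∀ {p p′} → p ≋ p′ → ⊖ p ≋ ⊖ p′
  ⊖-cong {p} {p′} p≋ = by-coeff _ _ (coeff-⊖ p) (coeff-⊖ p′) (λ n → -‿cong (coeff-≈ p≋ n))

  ⊙-cong : ∀ {a a′ p p′} → a ≈ a′ → p ≋ p′ → a ⊙ p ≋ a′ ⊙ p′
  ⊙-cong {a} {a′} {p} {p′} a≈ p≋ = by-coeff _ _ (coeff-⊙ a p) (coeff-⊙ a′ p′) (λ n → *-cong a≈ (coeff-≈ p≋ n))

  ⊙-zero : ∀ {a} p → a ≈ 0# → a ⊙ p ≋ []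
  ⊙-zero {a} p a≈0 = mk≋ (λ n → trans (coeff-⊙ a p n) (trans (*-congʳ a≈0) (zeroˡ _)))

  ⊗-zeroˡ : ∀ p q → p ≋ [] → p ⊗ q ≋ []
  ⊗-zeroˡ []      q p≋0 = ≋-refl
  ⊗-zeroˡ (a ∷ p) q p≋0 = ⊕-cong (⊙-zero q (coeff-≈ p≋0 zero)) (0∷-zero (⊗-zeroˡ p q (mk≋ (λ n → coeff-≈ p≋0 (suc n)))))

  ⊗-zeroʳ : ∀ p → p ⊗ [] ≋ []
  ⊗-zeroʳ []      = ≋-refl
  ⊗-zeroʳ (a ∷ p) = 0∷-zero (⊗-zeroʳ p)

  ⊗-congʳ : ∀ p {q q′} → q ≋ q′ → p ⊗ q ≋ p ⊗ q′
  ⊗-congʳ []      q≋ = ≋-refl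
  ⊗-congʳ (a ∷ p) q≋ = ⊕-cong (⊙-cong refl q≋) (∷-cong refl (⊗-congʳ p q≋))

  ⊗-congˡ : ∀ {p p′} q → p ≋ p′ → p ⊗ q ≋ p′ ⊗ q
  ⊗-congˡ {[]}    {[]}     q p≋ = ≋-refl
  ⊗-congˡ {[]}    {a ∷ p′} q p≋ = ≋-sym (⊗-zeroˡ (a ∷ p′) q (≋-sym p≋))
  ⊗-congˡ {a ∷ p} {[]}     q p≋ = ⊗-zeroˡ (a ∷ p) q p≋
  ⊗-congˡ {a ∷ p} {a′ ∷ p′} q p≋ = ⊕-cong (⊙-cong (coeff-≈ p≋ zero) ≋-refl) (∷-cong refl (⊗-congˡ q (∷-injectiveʳ p≋)))

  ⊗-cong : ∀ {p p′ q q′} → p ≋ p′ → q ≋ q′ → p ⊗ q ≋ p′ ⊗ q′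
  ⊗-cong {p′ = p′} {q = q} p≋ q≋ = ≋-trans (⊗-congˡ q p≋) (⊗-congʳ p′ q≋)

  ⊕-assoc : ∀ p q r → (p ⊕ q) ⊕ r ≋ p ⊕ (q ⊕ r)
  ⊕-assoc p q r = by-coeff _ _
    (λ n → trans (coeff-⊕ (p ⊕ q) r n) (+-congʳ (coeff-⊕ p q n)))
    (λ n → trans (coeff-⊕ p (q ⊕ r) n) (+-congˡ (coeff-⊕ q r n)))
    (λ n → +-assoc _ _ _)

  ⊕-comm : ∀ p q → p ⊕ q ≋ q ⊕ p
  ⊕-comm p q = by-coeff _ _ (coeff-⊕ p q) (coeff-⊕ q p) (λ n → +-comm _ _)

  ⊕-identityʳ : ∀ p → p ⊕ [] ≋ p
  ⊕-identityʳ p = mk≋ (λ n → trans (coeff-⊕ p [] n) (+-identityʳ _))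

  ⊖-inverseˡ : ∀ p → ⊖ p ⊕ p ≋ []
  ⊖-inverseˡ p = mk≋ (λ n → trans (coeff-⊕ (⊖ p) p n) (trans (+-congʳ (coeff-⊖ p n)) (-‿inverseˡ _)))

  ⊖-inverseʳ : ∀ p → p ⊕ ⊖ p ≋ []
  ⊖-inverseʳ p = mk≋ (λ n → trans (coeff-⊕ p (⊖ p) n) (trans (+-congˡ (coeff-⊖ p n)) (-‿inverseʳ _)))

  ⊙-distribˡ : ∀ a p q → a ⊙ (p ⊕ q) ≋ a ⊙ p ⊕ a ⊙ q
  ⊙-distribˡ a p q = by-coeff _ _
    (λ n → trans (coeff-⊙ a (p ⊕ q) n) (*-congˡ (coeff-⊕ p q n)))
    (λ n → trans (coeff-⊕ (a ⊙ p) (a ⊙ q) n) (+-cong (coeff-⊙ a p n) (coeff-⊙ a q n)))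
    (λ n → distribˡ _ _ _)

  ⊙-distribʳ : ∀ a b p → (a + b) ⊙ p ≋ a ⊙ p ⊕ b ⊙ p
  ⊙-distribʳ a b p = by-coeff _ _
    (coeff-⊙ (a + b) p)
    (λ n → trans (coeff-⊕ (a ⊙ p) (b ⊙ p) n) (+-cong (coeff-⊙ a p n) (coeff-⊙ b p n)))
    (λ n → distribʳ _ _ _)

  ⊙-assoc : ∀ a b p → a ⊙ (b ⊙ p) ≋ (a * b) ⊙ p
  ⊙-assoc a b p = by-coeff _ _
    (λ n → trans (coeff-⊙ a (b ⊙ p) n) (*-congˡ (coeff-⊙ b p n))) (coeff-⊙ (a * b) p) (λ n → sym (*-assoc _ _ _))

  ⊕-interchange : ∀ w x y z → (w ⊕ x) ⊕ (y ⊕ z) ≋ (w ⊕ y) ⊕ (x ⊕ z)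
  ⊕-interchange w x y z = by-coeff _ _
    (λ n → trans (coeff-⊕ (w ⊕ x) (y ⊕ z) n) (+-cong (coeff-⊕ w x n) (coeff-⊕ y z n)))
    (λ n → trans (coeff-⊕ (w ⊕ y) (x ⊕ z) n) (+-cong (coeff-⊕ w y n) (coeff-⊕ x z n)))
    (λ n → solve 4 (λ a b c d → (a :+ b) :+ (c :+ d) := (a :+ c) :+ (b :+ d)) refl _ _ _ _)

  ⊗-distribʳ : ∀ r p q → (p ⊕ q) ⊗ r ≋ p ⊗ r ⊕ q ⊗ r
  ⊗-distribʳ r []      q       = ≋-refl
  ⊗-distribʳ r (a ∷ p) []      = ≋-sym (⊕-identityʳ ((a ∷ p) ⊗ r))
  ⊗-distribʳ r (a ∷ p) (b ∷ q) =
    ≋-trans (⊕-cong (⊙-distribʳ a b r) (∷-cong (sym (+-identityˡ 0#)) (⊗-distribʳ r p q)))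
            (⊕-interchange (a ⊙ r) (b ⊙ r) (0# ∷ p ⊗ r) (0# ∷ q ⊗ r))

  ⊙-⊗ : ∀ a q r → (a ⊙ q) ⊗ r ≋ a ⊙ (q ⊗ r)
  ⊙-⊗ a []      r = ≋-refl
  ⊙-⊗ a (b ∷ q) r =
    ≋-trans (⊕-cong (≋-sym (⊙-assoc a b r)) (∷-cong (sym (zeroʳ a)) (⊙-⊗ a q r)))
            (≋-sym (⊙-distribˡ a (b ⊙ r) (0# ∷ q ⊗ r)))

  ⊗-assoc : ∀ p q r → (p ⊗ q) ⊗ r ≋ p ⊗ (q ⊗ r)
  ⊗-assoc []      q r = ≋-refl
  ⊗-assoc (a ∷ p) q r =
    ≋-trans (⊗-distribʳ r (a ⊙ q) (0# ∷ p ⊗ q))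
            (⊕-cong (⊙-⊗ a q r) (≋-trans (⊕-cong (⊙-zero r refl) ≋-refl) (∷-cong refl (⊗-assoc p q r))))

  ⊗-∷ʳ : ∀ p b q → p ⊗ (b ∷ q) ≋ b ⊙ p ⊕ (0# ∷ p ⊗ q)
  ⊗-∷ʳ []      b q = mk≋ (λ { zero → refl ; (suc n) → refl })
  ⊗-∷ʳ (a ∷ p) b q = mk≋ λ
    { zero    → trans (+-identityʳ _) (trans (*-comm a b) (sym (+-identityʳ _)))
    ; (suc n) → begin
        coeff (a ⊙ q ⊕ p ⊗ (b ∷ q)) n                     ≈⟨ coeff-⊕ (a ⊙ q) (p ⊗ (b ∷ q)) n ⟩
        coeff (a ⊙ q) n + coeff (p ⊗ (b ∷ q)) n           ≈⟨ +-congˡ (coeff-≈ (⊗-∷ʳ p b q) n) ⟩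
        coeff (a ⊙ q) n + coeff (b ⊙ p ⊕ (0# ∷ p ⊗ q)) n   ≈⟨ +-congˡ (coeff-⊕ (b ⊙ p) (0# ∷ p ⊗ q) n) ⟩
        coeff (a ⊙ q) n + (coeff (b ⊙ p) n + coeff (0# ∷ p ⊗ q) n)
          ≈⟨ solve 3 (λ x y z → x :+ (y :+ z) := y :+ (x :+ z)) refl _ _ _ ⟩
        coeff (b ⊙ p) n + (coeff (a ⊙ q) n + coeff (0# ∷ p ⊗ q) n)
          ≈⟨ sym (trans (coeff-⊕ (b ⊙ p) (a ⊙ q ⊕ (0# ∷ p ⊗ q)) n) (+-congˡ (coeff-⊕ (a ⊙ q) (0# ∷ p ⊗ q) n))) ⟩
        coeff (b ⊙ p ⊕ (a ⊙ q ⊕ (0# ∷ p ⊗ q))) n ∎ }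

  ⊗-comm : ∀ p q → p ⊗ q ≋ q ⊗ p
  ⊗-comm []      q = ≋-sym (⊗-zeroʳ q)
  ⊗-comm (a ∷ p) q = ≋-trans (⊕-cong ≋-refl (∷-cong refl (⊗-comm p q))) (≋-sym (⊗-∷ʳ q a p))

  ⊗-identityˡ : ∀ p → (1# ∷ []) ⊗ p ≋ p
  ⊗-identityˡ p = mk≋ (λ n → trans (coeff-⊕ (1# ⊙ p) (0# ∷ []) n)
    (trans (+-cong (trans (coeff-⊙ 1# p n) (*-identityˡ _)) (coeff-≈ (0∷-zero (≋-refl {[]})) n)) (+-identityʳ _)))

  R[T]-isCommutativeRing : IsCommutativeRing _≋_ _⊕_ _⊗_ ⊖_ [] (1# ∷ [])
  R[T]-isCommutativeRing = record
    { isRing = record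
      { +-isAbelianGroup = record
        { isGroup = record
          { isMonoid = record
            { isSemigroup = record
              { isMagma = record
                { isEquivalence = record { refl = ≋-refl ; sym = ≋-sym ; trans = ≋-trans }
                ; ∙-cong = ⊕-cong }
              ; assoc = ⊕-assoc }
            ; identity = (λ p → ≋-refl) , ⊕-identityʳ }
          ; inverse = ⊖-inverseˡ , ⊖-inverseʳ
          ; ⁻¹-cong = ⊖-cong }
        ; comm = ⊕-comm }
      ; *-cong = ⊗-cong
      ; *-assoc = ⊗-assoc
      ; *-identity = ⊗-identityˡ , (λ p → ≋-trans (⊗-comm p (1# ∷ [])) (⊗-identityˡ p))
      ; distrib = (λ p q r → ≋-trans (⊗-comm p (q ⊕ r)) (≋-trans (⊗-distribʳ p q r) (⊕-cong (⊗-comm q p) (⊗-comm r p))))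
                , (λ p q r → ⊗-distribʳ p q r) }
    ; *-comm = ⊗-comm }

  R[T] : CommutativeRing c ℓ
  R[T] = record { isCommutativeRing = R[T]-isCommutativeRing }

  eval₁ : Poly → Carrier
  eval₁ []      = 0#
  eval₁ (a ∷ p) = a + eval₁ p

  eval₁-cong : ∀ {p q} → p ≋ q → eval₁ p ≈ eval₁ q
  eval₁-cong {[]}    {[]}    p≋q = refl
  eval₁-cong {[]}    {b ∷ q} p≋q =
    sym (trans (+-cong (sym (coeff-≈ p≋q zero)) (sym (eval₁-cong {[]} {q} (mk≋ (λ n → coeff-≈ p≋q (suc n)))))) (+-identityˡ 0#))
  eval₁-cong {a ∷ p} {[]}    p≋q =
    trans (+-cong (coeff-≈ p≋q zero) (eval₁-cong {p} {[]} (mk≋ (λ n → coeff-≈ p≋q (suc n))))) (+-identityˡ 0#)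
  eval₁-cong {a ∷ p} {b ∷ q} p≋q = +-cong (coeff-≈ p≋q zero) (eval₁-cong (∷-injectiveʳ p≋q))

  eval₁-⊕ : ∀ p q → eval₁ (p ⊕ q) ≈ eval₁ p + eval₁ q
  eval₁-⊕ []      q       = sym (+-identityˡ _)
  eval₁-⊕ (a ∷ p) []      = sym (+-identityʳ _)
  eval₁-⊕ (a ∷ p) (b ∷ q) =
    trans (+-congˡ (eval₁-⊕ p q)) (solve 4 (λ a b x y → (a :+ b) :+ (x :+ y) := (a :+ x) :+ (b :+ y)) refl _ _ _ _)

  eval₁-⊖ : ∀ p → eval₁ (⊖ p) ≈ - eval₁ p
  eval₁-⊖ []      = solve 0 (con (+ 0) := :- con (+ 0)) refl
  eval₁-⊖ (a ∷ p) = trans (+-congˡ (eval₁-⊖ p)) (solve 2 (λ a x → :- a :+ :- x := :- (a :+ x)) refl _ _)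

  eval₁-⊙ : ∀ a p → eval₁ (a ⊙ p) ≈ a * eval₁ p
  eval₁-⊙ a []      = sym (zeroʳ a)
  eval₁-⊙ a (b ∷ p) = trans (+-congˡ (eval₁-⊙ a p)) (sym (distribˡ _ _ _))

  eval₁-⊗ : ∀ p q → eval₁ (p ⊗ q) ≈ eval₁ p * eval₁ q
  eval₁-⊗ []      q = sym (zeroˡ _)
  eval₁-⊗ (a ∷ p) q =
    trans (eval₁-⊕ (a ⊙ q) (0# ∷ p ⊗ q))
          (trans (+-cong (eval₁-⊙ a q) (+-congˡ (eval₁-⊗ p q)))
                 (solve 3 (λ a x y → a :* y :+ (con (+ 0) :+ x :* y) := (a :+ x) :* y) refl _ _ _))

  eval₁-isRingHomomorphism : IsRingHomomorphism (CommutativeRing.rawRing R[T]) rawRing eval₁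
  eval₁-isRingHomomorphism = record
    { isSemiringHomomorphism = record
      { isNearSemiringHomomorphism = record
        { +-isMonoidHomomorphism = record
          { isMagmaHomomorphism = record { isRelHomomorphism = record { cong = eval₁-cong } ; homo = eval₁-⊕ }
          ; ε-homo = refl }
        ; *-homo = eval₁-⊗ }
      ; 1#-homo = +-identityʳ 1# }
    ; -‿homo = eval₁-⊖ }

  -- The constant term of a ⊗ (d₀ ∷ d) is d₀, and once d₀ ≈ 0 its tail is a ⊗ d.
  constant-one⇒annihilates-nothing : ∀ a → coeff a 0 ≈ 1# → ∀ d → a ⊗ d ≋ [] → d ≋ []
  constant-one⇒annihilates-nothing a a₀≈1 []       ad≋0 = ≋-refl
  constant-one⇒annihilates-nothing a a₀≈1 (d₀ ∷ d) ad≋0 =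
    mk≋ λ { zero → d₀≈0 ; (suc n) → coeff-≈ (constant-one⇒annihilates-nothing a a₀≈1 d ad′≋0) n }
    where
    ad≋ : d₀ ⊙ a ⊕ (0# ∷ a ⊗ d) ≋ []
    ad≋ = ≋-trans (≋-sym (⊗-∷ʳ a d₀ d)) ad≋0
    d₀≈0 : d₀ ≈ 0#
    d₀≈0 = begin
      d₀                               ≈⟨ sym (*-identityʳ d₀) ⟩
      d₀ * 1#                          ≈⟨ *-congˡ (sym a₀≈1) ⟩
      d₀ * coeff a 0                   ≈⟨ sym (coeff-⊙ d₀ a 0) ⟩
      coeff (d₀ ⊙ a) 0                 ≈⟨ sym (+-identityʳ _) ⟩
      coeff (d₀ ⊙ a) 0 + 0#            ≈⟨ sym (coeff-⊕ (d₀ ⊙ a) (0# ∷ a ⊗ d) 0) ⟩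
      coeff (d₀ ⊙ a ⊕ (0# ∷ a ⊗ d)) 0  ≈⟨ coeff-≈ ad≋ 0 ⟩
      0#                               ∎
    ad′≋0 : a ⊗ d ≋ []
    ad′≋0 = mk≋ λ n → begin
      coeff (a ⊗ d) n                                      ≈⟨ sym (+-identityˡ _) ⟩
      0# + coeff (a ⊗ d) n                                 ≈⟨ +-congʳ (sym (coeff-≈ (⊙-zero a d₀≈0) (suc n))) ⟩
      coeff (d₀ ⊙ a) (suc n) + coeff (0# ∷ a ⊗ d) (suc n)  ≈⟨ sym (coeff-⊕ (d₀ ⊙ a) (0# ∷ a ⊗ d) (suc n)) ⟩
      coeff (d₀ ⊙ a ⊕ (0# ∷ a ⊗ d)) (suc n)                ≈⟨ coeff-≈ ad≋ (suc n) ⟩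
      0#                                                   ∎

  constant-one⇒cancellable : ∀ a → coeff a 0 ≈ 1# → FiniteProducts.Cancellable R[T] a
  constant-one⇒cancellable a a₀≈1 y z ay≋az =
    ≋-trans (PS.solve 2 (λ y z → y PS.:= (y PS.:- z) PS.:+ z) ≋-refl y z)
            (⊕-cong (constant-one⇒annihilates-nothing a a₀≈1 (y ⊕ ⊖ z) a[y-z]≋0) ≋-refl)
    where
    module PS = IntegerCoefficientSolver R[T]
    a[y-z]≋0 : a ⊗ (y ⊕ ⊖ z) ≋ []
    a[y-z]≋0 = ≋-trans (PS.solve 3 (λ a y z → a PS.:* (y PS.:- z) PS.:= a PS.:* y PS.:- a PS.:* z) ≋-refl a y z)
                       (≋-trans (⊕-cong ay≋az ≋-refl) (⊖-inverseʳ (a ⊗ z)))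

module HomomorphicImage {c₁ ℓ₁ c₂ ℓ₂ : Level} (R₁ : CommutativeRing c₁ ℓ₁) (R₂ : CommutativeRing c₂ ℓ₂)
  (h : CommutativeRing.Carrier R₁ → CommutativeRing.Carrier R₂)
  (h-isRingHomomorphism : IsRingHomomorphism (CommutativeRing.rawRing R₁) (CommutativeRing.rawRing R₂) h) where
  private
    module A = CommutativeRing R₁
    module B = CommutativeRing R₂
    module DA = RingDefs R₁
    module DB = RingDefs R₂
    module FB = FiniteProducts R₂
    module DetA = Determinant R₁
    module LA = LinearForms R₁
    module LB = LinearForms R₂
  open B using (_≈_; refl; sym; trans)
  open IsRingHomomorphism h-isRingHomomorphism

  h-sumFin : ∀ n f → h (DA.sumFin n f) ≈ DB.sumFin n (λ i → h (f i))
  h-sumFin zero    f = 0#-homo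
  h-sumFin (suc n) f = trans (+-homo _ _) (B.+-congˡ (h-sumFin n (λ i → f (suc i))))

  h-prodFin : ∀ n f → h (DA.prodFin n f) ≈ DB.prodFin n (λ i → h (f i))
  h-prodFin zero    f = 1#-homo
  h-prodFin (suc n) f = trans (*-homo _ _) (B.*-congˡ (h-prodFin n (λ i → f (suc i))))

  h-sign : ∀ n → h (DA.pow (A.- A.1#) n) ≈ DB.pow (B.- B.1#) n
  h-sign zero    = 1#-homo
  h-sign (suc n) = trans (*-homo _ _) (B.*-cong (trans (-‿homo A.1#) (B.-‿cong 1#-homo)) (h-sign n))

  h-if : ∀ b x → h (if b then x else A.1#) ≈ (if b then h x else B.1#)
  h-if true  x = refl
  h-if false x = 1#-homo

  h-det : ∀ n M → h (DA.det n M) ≈ DB.det n (λ i j → h (M i j))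
  h-det zero    M = 1#-homo
  h-det (suc n) M = trans (h-sumFin (suc n) (DetA.expansionTerm M)) (FB.sumFin-cong (suc n) (λ j →
    trans (*-homo (DA.pow (A.- A.1#) (toℕ j)) _)
          (B.*-cong (h-sign (toℕ j)) (trans (*-homo (M zero j) _) (B.*-congˡ (h-det n (DetA.minor M j)))))))

  hₚ : LA.Point → LB.Point
  hₚ (x , y) = h x , h y

  h-· : ∀ l x → h (l LA.· x) ≈ hₚ l LB.· hₚ x
  h-· l x = trans (+-homo _ _) (B.+-cong (*-homo _ _) (*-homo _ _))

  h-∧ : ∀ u x → h (u LA.∧ x) ≈ hₚ u LB.∧ hₚ x
  h-∧ u x = trans (+-homo _ _) (B.+-cong (*-homo _ _) (trans (-‿homo _) (B.-‿cong (*-homo _ _))))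

  h-formProduct : ∀ m L M j x →
    h (LA.formProduct m L M j x) ≈ LB.formProduct m (λ t → hₚ (L t)) (λ t → hₚ (M t)) j (hₚ x)
  h-formProduct m L M j x = trans (*-homo _ _) (B.*-cong
    (trans (h-prodFin m _) (FB.prodFin-cong m (λ t → trans (h-if _ _) (LB.if-congˡ _ (h-· (L t) x)))))
    (trans (h-prodFin m _) (FB.prodFin-cong m (λ t → trans (h-if _ _) (LB.if-congˡ _ (h-· (M t) x))))))

  h-bracketVandermonde : ∀ n v → h (LA.bracketVandermonde n v) ≈ LB.bracketVandermonde n (λ i → hₚ (v i))
  h-bracketVandermonde zero    v = 1#-homo
  h-bracketVandermonde (suc n) v = trans (*-homo _ _) (B.*-cong
    (trans (h-prodFin n _) (FB.prodFin-cong n (λ i → h-∧ (v zero) (v (suc i)))))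
    (h-bracketVandermonde n (λ i → v (suc i))))

  h-upperProduct : ∀ m X → h (LA.upperProduct m X) ≈ LB.upperProduct m (λ i j → h (X i j))
  h-upperProduct m X =
    trans (h-prodFin m _) (FB.prodFin-cong m (λ j → trans (h-prodFin m _) (FB.prodFin-cong m (λ i → h-if _ _))))

module FormDeterminant {c ℓ : Level} (R : CommutativeRing c ℓ) where
  open CommutativeRing R hiding (zero)
  open RingDefs R
  open IntegerCoefficientSolver R
  open Determinant R
  open LinearForms R
  open Polynomial R
  open import Relation.Binary.Reasoning.Setoid setoid
  private
    module P = LinearForms R[T]
    module PF = FormDeterminantCancellative R[T]
    module PFin = FiniteProducts R[T]
  open HomomorphicImage R[T] R eval₁ eval₁-isRingHomomorphism

  -- The point (1 − T)(1, 0) + T u: pairings of two of them have constant term 1.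
  generic : Point → P.Point
  generic (x , y) = (1# ∷ x - 1# ∷ []) , (0# ∷ y ∷ [])

  constant : Point → P.Point
  constant (x , y) = (x ∷ []) , (y ∷ [])

  eval₁-generic : ∀ u → hₚ (generic u) ≈ₚ u
  eval₁-generic (x , y) = solve 1 (λ x → con (+ 1) :+ ((x :- con (+ 1)) :+ con (+ 0)) := x) refl x
                        , solve 1 (λ y → con (+ 0) :+ (y :+ con (+ 0)) := y) refl y

  eval₁-constant : ∀ u → hₚ (constant u) ≈ₚ u
  eval₁-constant (x , y) = +-identityʳ x , +-identityʳ y

  generic-·-cancellable : ∀ l x → PFin.Cancellable (generic l P.· generic x)
  generic-·-cancellable (l₁ , l₂) (x₁ , x₂) = constant-one⇒cancellable (generic (l₁ , l₂) P.· generic (x₁ , x₂)) (begin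
    coeff ((1# ∷ l₁ - 1# ∷ []) ⊗ (1# ∷ x₁ - 1# ∷ []) ⊕ (0# ∷ l₂ ∷ []) ⊗ (0# ∷ x₂ ∷ [])) 0
      ≈⟨ coeff-⊕ ((1# ∷ l₁ - 1# ∷ []) ⊗ (1# ∷ x₁ - 1# ∷ [])) ((0# ∷ l₂ ∷ []) ⊗ (0# ∷ x₂ ∷ [])) 0 ⟩
    coeff ((1# ∷ l₁ - 1# ∷ []) ⊗ (1# ∷ x₁ - 1# ∷ [])) 0 + coeff ((0# ∷ l₂ ∷ []) ⊗ (0# ∷ x₂ ∷ [])) 0
      ≈⟨ +-cong (coeff₀-⊗ (1# ∷ l₁ - 1# ∷ []) (1# ∷ x₁ - 1# ∷ [])) (coeff₀-⊗ (0# ∷ l₂ ∷ []) (0# ∷ x₂ ∷ [])) ⟩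
    1# * 1# + 0# * 0#
      ≈⟨ solve 0 (con (+ 1) :* con (+ 1) :+ con (+ 0) :* con (+ 0) := con (+ 1)) refl ⟩
    1# ∎)

  det-formMatrix : ∀ m (v : Fin (suc m) → Point) (L M : Fin m → Point) →
    det (suc m) (formMatrix m v L M) ≈ bracketVandermonde (suc m) v * upperProduct m (λ i j → L j ∧ M i)
  det-formMatrix m v L M = begin
    det (suc m) (formMatrix m v L M)
      ≈⟨ det-cong (suc m) (λ i j → sym (trans (h-formProduct m Lᵍ Mᶜ (toℕ j) (vᵍ i))
           (formProduct-cong m (toℕ j) (λ t → eval₁-generic (L t)) (λ t → eval₁-constant (M t)) (eval₁-generic (v i))))) ⟩
    det (suc m) (λ i j → eval₁ (P.formMatrix m vᵍ Lᵍ Mᶜ i j))  ≈⟨ sym (h-det (suc m) (P.formMatrix m vᵍ Lᵍ Mᶜ)) ⟩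
    eval₁ (RingDefs.det R[T] (suc m) (P.formMatrix m vᵍ Lᵍ Mᶜ))
      ≈⟨ eval₁-cong (PF.det-formMatrix-cancellative m vᵍ Lᵍ Mᶜ (λ i t → generic-·-cancellable (L t) (v i))) ⟩
    eval₁ (P.bracketVandermonde (suc m) vᵍ ⊗ P.upperProduct m (λ i j → Lᵍ j P.∧ Mᶜ i))
      ≈⟨ eval₁-⊗ (P.bracketVandermonde (suc m) vᵍ) _ ⟩
    eval₁ (P.bracketVandermonde (suc m) vᵍ) * eval₁ (P.upperProduct m (λ i j → Lᵍ j P.∧ Mᶜ i))
      ≈⟨ *-cong (trans (h-bracketVandermonde (suc m) vᵍ) (bracketVandermonde-cong (suc m) (λ i → eval₁-generic (v i))))
                (trans (h-upperProduct m _) (upperProduct-cong m (λ i j →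
                   trans (h-∧ (Lᵍ j) (Mᶜ i)) (∧-cong (eval₁-generic (L j)) (eval₁-constant (M i)))))) ⟩
    bracketVandermonde (suc m) v * upperProduct m (λ i j → L j ∧ M i) ∎
    where
    vᵍ : Fin (suc m) → P.Point
    vᵍ i = generic (v i)
    Lᵍ Mᶜ : Fin m → P.Point
    Lᵍ t = generic (L t)
    Mᶜ t = constant (M t)

module IntegerInduction where

  spread-from-zero : ∀ {p} (D : ℤ → Set p) → (∀ N → D N → D (ℤ.suc N)) → (∀ N → D (ℤ.suc N) → D N) →
    D (+ 0) → ∀ N → D N
  spread-from-zero D up down d₀ (+ zero)      = d₀
  spread-from-zero D up down d₀ (+ suc n)     = up (+ n) (spread-from-zero D up down d₀ (+ n))
  spread-from-zero D up down d₀ -[1+ zero ]   = down -[1+ zero ] d₀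
  spread-from-zero D up down d₀ -[1+ suc n ]  = down -[1+ suc n ] (spread-from-zero D up down d₀ -[1+ n ])

  move-to-zero : ∀ {p} (D : ℤ → Set p) → (∀ N → D N → D (ℤ.suc N)) → (∀ N → D (ℤ.suc N) → D N) →
    ∀ N → D N → D (+ 0)
  move-to-zero D up down (+ zero)     d = d
  move-to-zero D up down (+ suc n)    d = move-to-zero D up down (+ n) (down (+ n) d)
  move-to-zero D up down -[1+ zero ]  d = up -[1+ zero ] d
  move-to-zero D up down -[1+ suc n ] d = move-to-zero D up down -[1+ n ] (up -[1+ suc n ] d)

  spread : ∀ {p} (D : ℤ → Set p) → (∀ N → D N → D (ℤ.suc N)) → (∀ N → D (ℤ.suc N) → D N) →
    ∀ N₀ → D N₀ → ∀ N → D N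
  spread D up down N₀ d = spread-from-zero D up down (move-to-zero D up down N₀ d)

module Recurrences {c ℓ : Level} (R : CommutativeRing c ℓ) where
  open CommutativeRing R hiding (zero)
  open RingDefs R
  open IntegerCoefficientSolver R
  open IntegerInduction
  open import Relation.Binary.Reasoning.Setoid setoid

  first-order-unique : ∀ u u⁻¹ → u⁻¹ * u ≈ 1# → (f g : ℤ → Carrier) →
    (∀ N → f (ℤ.suc N) ≈ u * f N) → (∀ N → g (ℤ.suc N) ≈ u * g N) →
    ∀ N₀ → f N₀ ≈ g N₀ → ∀ N → f N ≈ g N
  first-order-unique u u⁻¹ inverse f g f-rec g-rec = spread (λ N → f N ≈ g N) up down
    where
    back : ∀ (h : ℤ → Carrier) → (∀ N → h (ℤ.suc N) ≈ u * h N) → ∀ N → h N ≈ u⁻¹ * h (ℤ.suc N)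
    back h h-rec N = sym (trans (*-congˡ (h-rec N)) (trans (sym (*-assoc _ _ _)) (trans (*-congʳ inverse) (*-identityˡ _))))
    up : ∀ N → f N ≈ g N → f (ℤ.suc N) ≈ g (ℤ.suc N)
    up N f≈g = trans (f-rec N) (trans (*-congˡ f≈g) (sym (g-rec N)))
    down : ∀ N → f (ℤ.suc N) ≈ g (ℤ.suc N) → f N ≈ g N
    down N f≈g = trans (back f f-rec N) (trans (*-congˡ f≈g) (sym (back g g-rec N)))

  module SecondOrder (w c′ c′⁻¹ : Carrier) (inverse : c′⁻¹ * c′ ≈ 1#) where

    Solution : (ℤ → Carrier) → Set ℓ
    Solution f = ∀ N → f (ℤ.suc (ℤ.suc N)) ≈ w * f (ℤ.suc N) + c′ * f N

    solution-back : ∀ f → Solution f → ∀ N → f N ≈ c′⁻¹ * (f (ℤ.suc (ℤ.suc N)) - w * f (ℤ.suc N))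
    solution-back f f-rec N = sym (begin
      c′⁻¹ * (f (ℤ.suc (ℤ.suc N)) - w * f (ℤ.suc N))           ≈⟨ *-congˡ (+-congʳ (f-rec N)) ⟩
      c′⁻¹ * ((w * f (ℤ.suc N) + c′ * f N) - w * f (ℤ.suc N))
        ≈⟨ solve 5 (λ ci c w f₁ f₀ → ci :* ((w :* f₁ :+ c :* f₀) :- w :* f₁) := (ci :* c) :* f₀) refl c′⁻¹ c′ w _ _ ⟩
      (c′⁻¹ * c′) * f N  ≈⟨ trans (*-congʳ inverse) (*-identityˡ _) ⟩
      f N                ∎)

    solution-unique : ∀ f g → Solution f → Solution g →
      ∀ N₀ → f N₀ ≈ g N₀ → f (ℤ.suc N₀) ≈ g (ℤ.suc N₀) → ∀ N → f N ≈ g N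
    solution-unique f g f-rec g-rec N₀ f≈g f≈g′ N = proj₁ (spread D up down N₀ (f≈g , f≈g′) N)
      where
      D : ℤ → Set ℓ
      D N = (f N ≈ g N) × (f (ℤ.suc N) ≈ g (ℤ.suc N))
      up : ∀ N → D N → D (ℤ.suc N)
      up N (e₀ , e₁) = e₁ , trans (f-rec N) (trans (+-cong (*-congˡ e₁) (*-congˡ e₀)) (sym (g-rec N)))
      down : ∀ N → D (ℤ.suc N) → D N
      down N (e₁ , e₂) =
        trans (solution-back f f-rec N) (trans (*-congˡ (+-cong e₂ (-‿cong (*-congˡ e₁)))) (sym (solution-back g g-rec N))) , e₁

  module _ (u u⁻¹ : Carrier) (inverse : u * u⁻¹ ≈ 1#) where
    zpow-suc : ∀ N → zpow u u⁻¹ (ℤ.suc N) ≈ u * zpow u u⁻¹ N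
    zpow-suc (+ n)        = refl
    zpow-suc -[1+ zero ]  = sym (trans (*-congˡ (*-identityʳ u⁻¹)) inverse)
    zpow-suc -[1+ suc n ] = sym (trans (sym (*-assoc _ _ _)) (trans (*-congʳ inverse) (*-identityˡ _)))

    private
      E+[1+F] : ∀ E F → E ℤ.+ (+ 1 ℤ.+ F) ≡ + 1 ℤ.+ (E ℤ.+ F)
      E+[1+F] = solve-∀
      E*[1+n] : ∀ E n → E ℤ.* (+ 1 ℤ.+ n) ≡ E ℤ.+ E ℤ.* n
      E*[1+n] = solve-∀
      zpow-cong : ∀ {E F} → E ≡ F → zpow u u⁻¹ E ≈ zpow u u⁻¹ F
      zpow-cong E≡F = reflexive (≡.cong (zpow u u⁻¹) E≡F)

    zpow-+ : ∀ E F → zpow u u⁻¹ (E ℤ.+ F) ≈ zpow u u⁻¹ E * zpow u u⁻¹ F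
    zpow-+ E = first-order-unique u u⁻¹ (trans (*-comm _ _) inverse)
      (λ F → zpow u u⁻¹ (E ℤ.+ F)) (λ F → zpow u u⁻¹ E * zpow u u⁻¹ F)
      (λ F → trans (zpow-cong (E+[1+F] E F)) (zpow-suc (E ℤ.+ F)))
      (λ F → trans (*-congˡ (zpow-suc F)) (solve 3 (λ a b c → a :* (b :* c) := b :* (a :* c)) refl _ _ _))
      (+ 0) (trans (zpow-cong (ℤP.+-identityʳ E)) (sym (*-identityʳ _)))

    pow-zpow : ∀ E n → pow (zpow u u⁻¹ E) n ≈ zpow u u⁻¹ (E ℤ.* + n)
    pow-zpow E zero    = sym (zpow-cong (ℤP.*-zeroʳ E))
    pow-zpow E (suc n) =
      trans (*-congˡ (pow-zpow E n)) (trans (sym (zpow-+ E (E ℤ.* + n))) (zpow-cong (≡.sym (E*[1+n] E (+ n)))))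

module PolynomialSequence {c ℓ : Level} (R : CommutativeRing c ℓ) (a b c₀ c₀⁻¹ x : CommutativeRing.Carrier R)
  (inverse : CommutativeRing._≈_ R (CommutativeRing._*_ R c₀ c₀⁻¹) (CommutativeRing.1# R)) where
  open CommutativeRing R hiding (zero)
  open RingDefs R
  open IntegerCoefficientSolver R
  open LinearForms R using (Point; _·_; _∧_)
  open Recurrences R
  open import Relation.Binary.Reasoning.Setoid setoid

  w : Carrier
  w = a * x + b

  open SecondOrder w c₀ c₀⁻¹ (trans (*-comm _ _) inverse)

  [-c]^_ : ℤ → Carrier
  [-c]^_ = zpow (- c₀) (- c₀⁻¹)

  -c-inverse : (- c₀) * (- c₀⁻¹) ≈ 1#
  -c-inverse = trans (solve 2 (λ c ci → (:- c) :* (:- ci) := c :* ci) refl c₀ c₀⁻¹) inverse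

  [-c]^-suc : ∀ N → [-c]^ (ℤ.suc N) ≈ - c₀ * [-c]^ N
  [-c]^-suc = zpow-suc (- c₀) (- c₀⁻¹) -c-inverse

  backward-step-inverts : ∀ y z → y ≈ w * z + c₀ * ((- (w * c₀⁻¹)) * z + c₀⁻¹ * y)
  backward-step-inverts y z = sym (begin
    w * z + c₀ * ((- (w * c₀⁻¹)) * z + c₀⁻¹ * y)
      ≈⟨ solve 5 (λ w z c ci y → w :* z :+ c :* ((:- (w :* ci)) :* z :+ ci :* y) := w :* z :+ (c :* ci) :* (y :- w :* z))
               refl w z c₀ c₀⁻¹ y ⟩
    w * z + (c₀ * c₀⁻¹) * (y - w * z)  ≈⟨ +-congˡ (trans (*-congʳ inverse) (*-identityˡ _)) ⟩
    w * z + (y - w * z)                ≈⟨ solve 2 (λ u y → u :+ (y :- u) := y) refl _ y ⟩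
    y                                  ∎)

  module Terms (p q r : Carrier) where
    P : ℤ → Carrier
    P = Pseq p q r a b c₀ c₀⁻¹ x

    Δ : Carrier
    Δ = DeltaP p q r a b c₀ c₀⁻¹ x

    P-solution : Solution P
    P-solution (+ n)              = refl
    P-solution -[1+ zero ]        = backward-step-inverts _ _
    P-solution -[1+ suc zero ]    = backward-step-inverts _ _
    P-solution -[1+ suc (suc n) ] = backward-step-inverts _ _

    consecutive : ℤ → Point
    consecutive N = P N , P (ℤ.suc N)

    cassiniForm : ℤ → Carrier
    cassiniForm N = P (ℤ.suc N) * P (ℤ.suc N) - w * P N * P (ℤ.suc N) - c₀ * (P N * P N)

    cassiniForm-suc : ∀ N → cassiniForm (ℤ.suc N) ≈ - c₀ * cassiniForm N
    cassiniForm-suc N = begin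
      P₂ * P₂ - w * P₁ * P₂ - c₀ * (P₁ * P₁)
        ≈⟨ +-congʳ (+-cong (*-cong (P-solution N) (P-solution N)) (-‿cong (*-congˡ (P-solution N)))) ⟩
      X * X - w * P₁ * X - c₀ * (P₁ * P₁)
        ≈⟨ solve 4 (λ w c p₀ p₁ → (w :* p₁ :+ c :* p₀) :* (w :* p₁ :+ c :* p₀)
                                   :- w :* p₁ :* (w :* p₁ :+ c :* p₀) :- c :* (p₁ :* p₁)
                     := (:- c) :* (p₁ :* p₁ :- w :* p₀ :* p₁ :- c :* (p₀ :* p₀))) refl w c₀ (P N) P₁ ⟩
      - c₀ * cassiniForm N ∎
      where
      P₁ = P (ℤ.suc N)
      P₂ = P (ℤ.suc (ℤ.suc N))
      X = w * P₁ + c₀ * P N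

    cassiniForm-0 : cassiniForm (+ 0) ≈ Δ
    cassiniForm-0 = solve 7 (λ p q r a b c x →
        (q :* x :+ r) :* (q :* x :+ r) :- (a :* x :+ b) :* p :* (q :* x :+ r) :- c :* (p :* p)
        := (q :* q :- a :* p :* q) :* (x :* x) :+ ((q :* r :+ q :* r) :- a :* p :* r :- b :* p :* q) :* x
           :+ (r :* r :- b :* p :* r :- c :* (p :* p))) refl p q r a b c₀ x

    cassini : ∀ N → cassiniForm N ≈ [-c]^ N * Δ
    cassini = first-order-unique (- c₀) (- c₀⁻¹) (trans (*-comm _ _) -c-inverse) cassiniForm (λ N → [-c]^ N * Δ)
      cassiniForm-suc (λ N → trans (*-congʳ ([-c]^-suc N)) (*-assoc _ _ _))
      (+ 0) (trans cassiniForm-0 (sym (*-identityˡ Δ)))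

  open Terms 0# 0# 1# public using () renaming (P to U; P-solution to U-solution; Δ to Δ-U)

  U-1 : U (+ 1) ≈ 1#
  U-1 = trans (+-congʳ (zeroˡ x)) (+-identityˡ 1#)

  U-[-1] : U -[1+ 0 ] ≈ c₀⁻¹
  U-[-1] = trans (+-cong (zeroʳ _) (*-congˡ U-1)) (trans (+-identityˡ _) (*-identityʳ c₀⁻¹))

  Δ-U≈1 : Δ-U ≈ 1#
  Δ-U≈1 = solve 4 (λ a b c x →
      (con (+ 0) :* con (+ 0) :- a :* con (+ 0) :* con (+ 0)) :* (x :* x)
      :+ ((con (+ 0) :* con (+ 1) :+ con (+ 0) :* con (+ 1)) :- a :* con (+ 0) :* con (+ 1) :- b :* con (+ 0) :* con (+ 0)) :* x
      :+ (con (+ 1) :* con (+ 1) :- b :* con (+ 0) :* con (+ 1) :- c :* (con (+ 0) :* con (+ 0)))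
      := con (+ 1)) refl a b c₀ x

  U-cong : ∀ {M N} → M ≡ N → U M ≈ U N
  U-cong M≡N = reflexive (≡.cong U M≡N)

  private
    [2+M]-N : ∀ M N → (+ 1 ℤ.+ (+ 1 ℤ.+ M)) ℤ.- N ≡ + 1 ℤ.+ (+ 1 ℤ.+ (M ℤ.- N))
    [2+M]-N = solve-∀
    [1+M]-N : ∀ M N → (+ 1 ℤ.+ M) ℤ.- N ≡ + 1 ℤ.+ (M ℤ.- N)
    [1+M]-N = solve-∀
    [1+N]-N : ∀ N → (+ 1 ℤ.+ N) ℤ.- N ≡ + 1
    [1+N]-N = solve-∀
    N-N : ∀ N → N ℤ.- N ≡ + 0
    N-N = solve-∀
    N+[2+K] : ∀ N K → N ℤ.+ (+ 1 ℤ.+ (+ 1 ℤ.+ K)) ≡ + 1 ℤ.+ (+ 1 ℤ.+ (N ℤ.+ K))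
    N+[2+K] = solve-∀
    N+[1+K] : ∀ N K → N ℤ.+ (+ 1 ℤ.+ K) ≡ + 1 ℤ.+ (N ℤ.+ K)
    N+[1+K] = solve-∀

  U-shifted-solution : ∀ N → Solution (λ M → U (M ℤ.- N))
  U-shifted-solution N M = begin
    U (ℤ.suc (ℤ.suc M) ℤ.- N)                   ≈⟨ U-cong ([2+M]-N M N) ⟩
    U (ℤ.suc (ℤ.suc (M ℤ.- N)))                 ≈⟨ U-solution (M ℤ.- N) ⟩
    w * U (ℤ.suc (M ℤ.- N)) + c₀ * U (M ℤ.- N)  ≈⟨ +-congʳ (*-congˡ (U-cong (≡.sym ([1+M]-N M N)))) ⟩
    w * U (ℤ.suc M ℤ.- N) + c₀ * U (M ℤ.- N)    ∎

  coefficientForm : ℤ → Point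
  coefficientForm K = c₀ * U (K ℤ.- + 1) , U K

  module Identities (p q r : Carrier) where
    open Terms p q r

    bracket : ∀ N M → consecutive N ∧ consecutive M ≈ - Δ * [-c]^ N * U (M ℤ.- N)
    bracket N M = trans (bracket-as-U N M)
                        (*-congʳ (trans (-‿cong (cassini N)) (solve 2 (λ z d → :- (z :* d) := :- d :* z) refl _ _)))
      where
      bracket-as-U : ∀ N M → consecutive N ∧ consecutive M ≈ - cassiniForm N * U (M ℤ.- N)
      bracket-as-U N = solution-unique (λ M → consecutive N ∧ consecutive M) (λ M → - cassiniForm N * U (M ℤ.- N))
        bracket-solution scaled-U-solution N at-N at-1+N
        where
        bracket-solution : Solution (λ M → consecutive N ∧ consecutive M)
        bracket-solution M =
          trans (+-cong (*-congˡ (P-solution (ℤ.suc M))) (-‿cong (*-congˡ (P-solution M))))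
                (solve 7 (λ w c pn pn₁ a₀ a₁ a₂ → pn :* (w :* a₂ :+ c :* a₁) :- pn₁ :* (w :* a₁ :+ c :* a₀)
                             := w :* (pn :* a₂ :- pn₁ :* a₁) :+ c :* (pn :* a₁ :- pn₁ :* a₀))
                       refl w c₀ (P N) (P (ℤ.suc N)) (P M) (P (ℤ.suc M)) (P (ℤ.suc (ℤ.suc M))))
        scaled-U-solution : Solution (λ M → - cassiniForm N * U (M ℤ.- N))
        scaled-U-solution M =
          trans (*-congˡ (U-shifted-solution N M))
                (solve 5 (λ q w c u₁ u₀ → q :* (w :* u₁ :+ c :* u₀) := w :* (q :* u₁) :+ c :* (q :* u₀)) refl _ w c₀ _ _)
        at-N : consecutive N ∧ consecutive N ≈ - cassiniForm N * U (N ℤ.- N)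
        at-N = begin
          P N * P (ℤ.suc N) - P (ℤ.suc N) * P N  ≈⟨ solve 2 (λ a b → a :* b :- b :* a := con (+ 0)) refl _ _ ⟩
          0#                                     ≈⟨ sym (zeroʳ _) ⟩
          - cassiniForm N * 0#                   ≈⟨ *-congˡ (sym (U-cong (N-N N))) ⟩
          - cassiniForm N * U (N ℤ.- N)          ∎
        at-1+N : consecutive N ∧ consecutive (ℤ.suc N) ≈ - cassiniForm N * U (ℤ.suc N ℤ.- N)
        at-1+N = begin
          P N * P (ℤ.suc (ℤ.suc N)) - P (ℤ.suc N) * P (ℤ.suc N)   ≈⟨ +-congʳ (*-congˡ (P-solution N)) ⟩
          P N * (w * P (ℤ.suc N) + c₀ * P N) - P (ℤ.suc N) * P (ℤ.suc N)
            ≈⟨ solve 4 (λ w c p₀ p₁ → p₀ :* (w :* p₁ :+ c :* p₀) :- p₁ :* p₁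
                          := (:- (p₁ :* p₁ :- w :* p₀ :* p₁ :- c :* (p₀ :* p₀))) :* con (+ 1)) refl w c₀ (P N) (P (ℤ.suc N)) ⟩
          - cassiniForm N * 1#                 ≈⟨ *-congˡ (sym (trans (U-cong ([1+N]-N N)) U-1)) ⟩
          - cassiniForm N * U (ℤ.suc N ℤ.- N)  ∎

    shift : ∀ N K → P (N ℤ.+ K) ≈ coefficientForm K · consecutive N
    shift N = solution-unique (λ K → P (N ℤ.+ K)) (λ K → coefficientForm K · consecutive N)
      shifted-solution form-solution (+ 0) at-0 at-1
      where
      shifted-solution : Solution (λ K → P (N ℤ.+ K))
      shifted-solution K = trans (reflexive (≡.cong P (N+[2+K] N K)))
        (trans (P-solution (N ℤ.+ K)) (+-congʳ (*-congˡ (reflexive (≡.cong P (≡.sym (N+[1+K] N K)))))))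
      form-solution : Solution (λ K → coefficientForm K · consecutive N)
      form-solution K = trans (+-cong (*-congʳ (*-congˡ (U-shifted-solution (+ 1) K))) (*-congʳ (U-solution K)))
        (solve 8 (λ c w a₁ a₀ pn b₁ b₀ p₁ → c :* (w :* a₁ :+ c :* a₀) :* pn :+ (w :* b₁ :+ c :* b₀) :* p₁
                    := w :* (c :* a₁ :* pn :+ b₁ :* p₁) :+ c :* (c :* a₀ :* pn :+ b₀ :* p₁))
               refl c₀ w _ _ (P N) _ _ (P (ℤ.suc N)))
      at-0 : P (N ℤ.+ + 0) ≈ coefficientForm (+ 0) · consecutive N
      at-0 = sym (begin
        c₀ * U -[1+ 0 ] * P N + 0# * P (ℤ.suc N)  ≈⟨ +-cong (*-congʳ (*-congˡ U-[-1])) (zeroˡ _) ⟩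
        c₀ * c₀⁻¹ * P N + 0#                      ≈⟨ trans (+-identityʳ _) (trans (*-congʳ inverse) (*-identityˡ _)) ⟩
        P N                                       ≡⟨ ≡.cong P (≡.sym (ℤP.+-identityʳ N)) ⟩
        P (N ℤ.+ + 0)                             ∎)
      at-1 : P (N ℤ.+ + 1) ≈ coefficientForm (+ 1) · consecutive N
      at-1 = sym (begin
        c₀ * U (+ 0) * P N + U (+ 1) * P (ℤ.suc N)
          ≈⟨ +-cong (trans (*-congʳ (zeroʳ c₀)) (zeroˡ _)) (trans (*-congʳ U-1) (*-identityˡ _)) ⟩
        0# + P (ℤ.suc N)                            ≈⟨ +-identityˡ _ ⟩
        P (ℤ.suc N)                                 ≡⟨ ≡.cong P (ℤP.+-comm (+ 1) N) ⟩
        P (N ℤ.+ + 1)                               ∎)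

  coefficientForm-∧ : ∀ K E → coefficientForm K ∧ coefficientForm E ≈ [-c]^ K * U (E ℤ.- K)
  coefficientForm-∧ K E = begin
    c₀ * U K₁ * U E - U K * (c₀ * U E₁)
      ≈⟨ +-cong (*-congˡ (U-cong (≡.sym (1+[E-1] E)))) (-‿cong (*-congʳ (U-cong (≡.sym (1+[E-1] K))))) ⟩
    c₀ * U K₁ * U (ℤ.suc E₁) - U (ℤ.suc K₁) * (c₀ * U E₁)
      ≈⟨ solve 5 (λ c a b d e → c :* a :* b :- d :* (c :* e) := c :* (a :* b :- d :* e)) refl c₀ _ _ _ _ ⟩
    c₀ * (U-terms.consecutive K₁ ∧ U-terms.consecutive E₁)  ≈⟨ *-congˡ (U-identities.bracket K₁ E₁) ⟩
    c₀ * (- Δ-U * [-c]^ K₁ * U (E₁ ℤ.- K₁))                ≈⟨ *-congˡ (*-congʳ (*-congʳ (-‿cong Δ-U≈1))) ⟩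
    c₀ * (- 1# * [-c]^ K₁ * U (E₁ ℤ.- K₁))
      ≈⟨ solve 3 (λ c z u → c :* ((:- con (+ 1)) :* z :* u) := ((:- c) :* z) :* u) refl c₀ _ _ ⟩
    (- c₀ * [-c]^ K₁) * U (E₁ ℤ.- K₁)  ≈⟨ *-cong (sym ([-c]^-suc K₁)) (U-cong ([E-1]-[K-1] E K)) ⟩
    [-c]^ (ℤ.suc K₁) * U (E ℤ.- K)     ≡⟨ ≡.cong (λ N → [-c]^ N * U (E ℤ.- K)) (1+[E-1] K) ⟩
    [-c]^ K * U (E ℤ.- K)              ∎
    where
    module U-terms = Terms 0# 0# 1#
    module U-identities = Identities 0# 0# 1#
    K₁ = K ℤ.- + 1
    E₁ = E ℤ.- + 1
    1+[E-1] : ∀ E → + 1 ℤ.+ (E ℤ.- + 1) ≡ E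
    1+[E-1] = solve-∀
    [E-1]-[K-1] : ∀ E K → (E ℤ.- + 1) ℤ.- (K ℤ.- + 1) ≡ E ℤ.- K
    [E-1]-[K-1] = solve-∀

module ArithmeticProgression {c ℓ : Level} (R : CommutativeRing c ℓ) (a b c₀ c₀⁻¹ x : CommutativeRing.Carrier R)
  (inverse : CommutativeRing._≈_ R (CommutativeRing._*_ R c₀ c₀⁻¹) (CommutativeRing.1# R))
  (p q r : CommutativeRing.Carrier R) (s k : ℤ) where
  open CommutativeRing R hiding (zero)
  open RingDefs R
  open IntegerCoefficientSolver R
  open FiniteProducts R
  open LinearForms R
  open Recurrences R
  open PolynomialSequence R a b c₀ c₀⁻¹ x inverse
  open Terms p q r
  open Identities p q r
  open import Relation.Binary.Reasoning.Setoid setoid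

  node : ℤ → ℕ → Point
  node n i = consecutive (s ℤ.+ k ℤ.* (n ℤ.+ + i))

  Uₖ : ℕ → Carrier
  Uₖ t = U (k ℤ.* + suc t)

  private
    [-c]^-cong : ∀ {E F} → E ≡ F → [-c]^ E ≈ [-c]^ F
    [-c]^-cong E≡F = reflexive (≡.cong [-c]^_ E≡F)

  brackets-with-first : ∀ n M → prodFin M (λ i → node n 0 ∧ node n (suc (toℕ i)))
                                 ≈ pow (- Δ) M * pow ([-c]^ (s ℤ.+ k ℤ.* n)) M * prodFin M (λ i → Uₖ (toℕ i))
  brackets-with-first n M = begin
    prodFin M (λ i → node n 0 ∧ node n (suc (toℕ i)))
      ≈⟨ prodFin-cong M (λ i → trans (bracket (s ℤ.+ k ℤ.* (n ℤ.+ + 0)) (s ℤ.+ k ℤ.* (n ℤ.+ + suc (toℕ i))))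
                                     (*-cong (*-congˡ ([-c]^-cong (n+0 s k n))) (U-cong (difference s k n (+ suc (toℕ i)))))) ⟩
    prodFin M (λ i → - Δ * [-c]^ (s ℤ.+ k ℤ.* n) * Uₖ (toℕ i))
      ≈⟨ trans (prodFin-* M (λ _ → - Δ * [-c]^ (s ℤ.+ k ℤ.* n)) (λ i → Uₖ (toℕ i))) (*-congʳ (prodFin-const M _)) ⟩
    pow (- Δ * [-c]^ (s ℤ.+ k ℤ.* n)) M * prodFin M (λ i → Uₖ (toℕ i))
      ≈⟨ *-congʳ (pow-* (- Δ) _ M) ⟩
    pow (- Δ) M * pow ([-c]^ (s ℤ.+ k ℤ.* n)) M * prodFin M (λ i → Uₖ (toℕ i)) ∎
    where
    n+0 : ∀ s k n → s ℤ.+ k ℤ.* (n ℤ.+ + 0) ≡ s ℤ.+ k ℤ.* n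
    n+0 = solve-∀
    difference : ∀ s k n T → (s ℤ.+ k ℤ.* (n ℤ.+ T)) ℤ.- (s ℤ.+ k ℤ.* (n ℤ.+ + 0)) ≡ k ℤ.* T
    difference = solve-∀

  exponent : ℤ → ℕ → ℤ
  exponent n M = (s ℤ.+ k ℤ.* n) ℤ.* + (M C 2) ℤ.+ k ℤ.* + (M C 3)

  private
    Pascal-2 : ∀ M → M ℕ.+ M C 2 ≡ suc M C 2
    Pascal-2 M = ≡.trans (≡.cong (ℕ._+ M C 2) (≡.sym (nC1≡n M))) (nCk+nC[k+1]≡[n+1]C[k+1] M 1)

    exponent-step : ∀ n M → (s ℤ.+ k ℤ.* n) ℤ.* + M ℤ.+ exponent (n ℤ.+ + 1) M ≡ exponent n (suc M)
    exponent-step n M = ≡.trans (regroup s k n (+ M) (+ (M C 2)) (+ (M C 3)))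
      (≡.cong₂ (λ u v → (s ℤ.+ k ℤ.* n) ℤ.* u ℤ.+ k ℤ.* v)
               (≡.trans (≡.sym (ℤP.pos-+ M (M C 2))) (≡.cong +_ (Pascal-2 M)))
               (≡.trans (≡.sym (ℤP.pos-+ (M C 2) (M C 3))) (≡.cong +_ (nCk+nC[k+1]≡[n+1]C[k+1] M 2))))
      where
      regroup : ∀ s k n M c₂ c₃ → (s ℤ.+ k ℤ.* n) ℤ.* M ℤ.+ ((s ℤ.+ k ℤ.* (n ℤ.+ + 1)) ℤ.* c₂ ℤ.+ k ℤ.* c₃)
                                  ≡ (s ℤ.+ k ℤ.* n) ℤ.* (M ℤ.+ c₂) ℤ.+ k ℤ.* (c₂ ℤ.+ c₃)
      regroup = solve-∀

    exponent-1 : ∀ n → exponent n 1 ≡ + 0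
    exponent-1 n = zero-exponent (s ℤ.+ k ℤ.* n) k
      where
      zero-exponent : ∀ X k → X ℤ.* + 0 ℤ.+ k ℤ.* + 0 ≡ + 0
      zero-exponent = solve-∀

    next-node : ∀ n t → s ℤ.+ k ℤ.* (n ℤ.+ + suc t) ≡ s ℤ.+ k ℤ.* ((n ℤ.+ + 1) ℤ.+ + t)
    next-node n t = ≡.cong (λ N → s ℤ.+ k ℤ.* N) (≡.trans (≡.cong (λ T → n ℤ.+ T) (ℤP.pos-+ 1 t)) (reassociate n (+ t)))
      where
      reassociate : ∀ n T → n ℤ.+ (+ 1 ℤ.+ T) ≡ (n ℤ.+ + 1) ℤ.+ T
      reassociate = solve-∀

  bracketVandermonde-nodes : ∀ m n →
    bracketVandermonde (suc m) (λ i → node n (toℕ i))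
    ≈ pow (- Δ) (suc m C 2) * [-c]^ (exponent n (suc m)) * prodFin m (λ t → pow (Uₖ (toℕ t)) (m ∸ toℕ t))
  bracketVandermonde-nodes zero n = sym (trans (*-congʳ (*-congˡ ([-c]^-cong (exponent-1 n))))
    (solve 0 (con (+ 1) :* con (+ 1) :* con (+ 1) := con (+ 1) :* con (+ 1)) refl))
  bracketVandermonde-nodes (suc m′) n = begin
    prodFin M (λ i → node n 0 ∧ node n (suc (toℕ i))) * bracketVandermonde M (λ i → node n (suc (toℕ i)))
      ≈⟨ *-cong (brackets-with-first n M)
                (trans (bracketVandermonde-cong M (λ i → reflexive (≡.cong P (next-node n (toℕ i))) ,
                                                         reflexive (≡.cong (λ N → P (ℤ.suc N)) (next-node n (toℕ i)))))
                       (bracketVandermonde-nodes m′ (n ℤ.+ + 1))) ⟩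
    pow (- Δ) M * pow ([-c]^ S) M * ∏U * (pow (- Δ) (M C 2) * [-c]^ (exponent (n ℤ.+ + 1) M) * stair′)
      ≈⟨ solve 6 (λ a b c d e f → a :* b :* c :* (d :* e :* f) := (a :* d) :* (b :* e) :* (c :* f)) refl _ _ _ _ _ _ ⟩
    (pow (- Δ) M * pow (- Δ) (M C 2)) * (pow ([-c]^ S) M * [-c]^ (exponent (n ℤ.+ + 1) M)) * (∏U * stair′)
      ≈⟨ *-cong (*-cong Δ-powers [-c]-powers) (prodFin-staircase m′ Uₖ) ⟩
    pow (- Δ) (suc M C 2) * [-c]^ (exponent n (suc M)) * prodFin M (λ t → pow (Uₖ (toℕ t)) (M ∸ toℕ t)) ∎
    where
    M = suc m′
    S = s ℤ.+ k ℤ.* n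
    ∏U = prodFin M (λ t → Uₖ (toℕ t))
    stair′ = prodFin m′ (λ t → pow (Uₖ (toℕ t)) (m′ ∸ toℕ t))
    Δ-powers : pow (- Δ) M * pow (- Δ) (M C 2) ≈ pow (- Δ) (suc M C 2)
    Δ-powers = trans (sym (pow-+ (- Δ) M (M C 2))) (reflexive (≡.cong (pow (- Δ)) (Pascal-2 M)))
    [-c]-powers : pow ([-c]^ S) M * [-c]^ (exponent (n ℤ.+ + 1) M) ≈ [-c]^ (exponent n (suc M))
    [-c]-powers = begin
      pow ([-c]^ S) M * [-c]^ (exponent (n ℤ.+ + 1) M)    ≈⟨ *-congʳ (pow-zpow (- c₀) (- c₀⁻¹) -c-inverse S M) ⟩
      [-c]^ (S ℤ.* + M) * [-c]^ (exponent (n ℤ.+ + 1) M)  ≈⟨ sym (zpow-+ (- c₀) (- c₀⁻¹) -c-inverse (S ℤ.* + M) _) ⟩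
      [-c]^ (S ℤ.* + M ℤ.+ exponent (n ℤ.+ + 1) M)        ≈⟨ [-c]^-cong (exponent-step n M) ⟩
      [-c]^ (exponent n (suc M))                          ∎

  entry-as-pairing : ∀ n i D → P (s ℤ.+ k ℤ.* (n ℤ.+ + i ℤ.+ D)) ≈ coefficientForm (k ℤ.* D) · node n i
  entry-as-pairing n i D = trans (reflexive (≡.cong P (≡.sym (split s k n (+ i) D)))) (shift (s ℤ.+ k ℤ.* (n ℤ.+ + i)) (k ℤ.* D))
    where
    split : ∀ s k n T D → (s ℤ.+ k ℤ.* (n ℤ.+ T)) ℤ.+ k ℤ.* D ≡ s ℤ.+ k ℤ.* (n ℤ.+ T ℤ.+ D)
    split = solve-∀

  forms : ∀ {m} → (Fin m → ℤ) → Fin m → Point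
  forms d t = coefficientForm (k ℤ.* d t)

  entry-as-formMatrix : ∀ m n (d e : Fin m → ℤ) (i j : Fin (suc m)) →
    prodFin m (λ t → if toℕ j ≤ᵇ toℕ t then P (s ℤ.+ k ℤ.* (n ℤ.+ + toℕ i ℤ.+ d t)) else 1#)
    * prodFin m (λ t → if toℕ t <ᵇ toℕ j then P (s ℤ.+ k ℤ.* (n ℤ.+ + toℕ i ℤ.+ e t)) else 1#)
    ≈ formMatrix m (λ i → node n (toℕ i)) (forms d) (forms e) i j
  entry-as-formMatrix m n d e i j =
    *-cong (prodFin-cong m (λ t → if-congˡ (toℕ j ≤ᵇ toℕ t) (entry-as-pairing n (toℕ i) (d t))))
           (prodFin-cong m (λ t → if-congˡ (toℕ t <ᵇ toℕ j) (entry-as-pairing n (toℕ i) (e t))))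

  forms-∧ : ∀ D E → coefficientForm (k ℤ.* D) ∧ coefficientForm (k ℤ.* E) ≈ [-c]^ (k ℤ.* D) * U (k ℤ.* (E ℤ.- D))
  forms-∧ D E = trans (coefficientForm-∧ (k ℤ.* D) (k ℤ.* E)) (*-congˡ (U-cong (factor k E D)))
    where
    factor : ∀ k E D → k ℤ.* E ℤ.- k ℤ.* D ≡ k ℤ.* (E ℤ.- D)
    factor = solve-∀

theorem3 : {cℓ ℓ : Level} (R : CommutativeRing cℓ ℓ) →
    let open CommutativeRing R
        open RingDefs R
    in (s k n : ℤ) (m : ℕ) → m ≥ 1 →
       (p q r a b c cinv x : Carrier) → c * cinv ≈ 1# →
       (d e : Fin m → ℤ) →
       let P = Pseq p q r a b c cinv x
           U = Pseq 0# 0# 1# a b c cinv x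
           negc = - c
           negcinv = - cinv
           entry : Fin (suc m) → Fin (suc m) → Carrier
           entry i j =
             prodFin m (λ t → if toℕ j ℕ.≤ᵇ toℕ t
                               then P (s ℤ.+ k ℤ.* (n ℤ.+ + toℕ i ℤ.+ d t)) else 1#)
             * prodFin m (λ t → if toℕ t <ᵇ toℕ j
                               then P (s ℤ.+ k ℤ.* (n ℤ.+ + toℕ i ℤ.+ e t)) else 1#)
       in det (suc m) entry ≈
          pow (- DeltaP p q r a b c cinv x) ((suc m) C 2)
          * zpow negc negcinv ((s ℤ.+ k ℤ.* n) ℤ.* + ((suc m) C 2) ℤ.+ k ℤ.* + ((suc m) C 3))
          * prodFin m (λ t → pow (U (k ℤ.* + (suc (toℕ t)))) (m ∸ toℕ t))
          * prodFin m (λ j → prodFin m (λ i → if toℕ i ℕ.≤ᵇ toℕ j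
               then zpow negc negcinv (k ℤ.* d j) * U (k ℤ.* (e i ℤ.- d j))
               else 1#))
theorem3 R s k n m _ p q r a b c c⁻¹ x inverse d e =
  trans (det-cong (suc m) (entry-as-formMatrix m n d e))
  (trans (det-formMatrix m (λ i → node n (toℕ i)) (forms d) (forms e))
         (*-cong (bracketVandermonde-nodes m n) (upperProduct-cong m (λ i j → forms-∧ (d j) (e i)))))
  where
  open CommutativeRing R
  open Determinant R using (det-cong)
  open LinearForms R using (upperProduct-cong)
  open FormDeterminant R using (det-formMatrix)
  open ArithmeticProgression R a b c c⁻¹ x inverse p q r s k
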